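{- Let $1\le k\le n$, $s=\lfloor n/k\rfloor+1$ and $t$ the remainder of $n$ upon division by $k$. Then \[H_{n,k}(x)=I(n,k,0)\,A_s(x)^t\,A_{s-1}(x)^{k-t},\] where \[I(n,k,0)=\prod_{j=1}^{k-1}\binom{n-\sum_{i=0}^{j-1}\lambda_i}{\lambda_j},\] with $\lambda_0=0$ and $\lambda_j=\lfloor (n-j)/k\rfloor+1$ for $1\le j\le k$ (the length of the $j$-th $k$-step run).
   Context: $S_n$ is the set of permutations of $\{1,\dots,n\}$. A $k$-step inversion of $\pi$ is a pair $(a,b)$ with $1\le a<b\le n$, $b-a=k$ and $\pi(a)>\pi(b)$; $\operatorname{inv}_k(\pi)$ is their number. $H_{n,k}(x)=\sum_{\pi\in S_n}x^{\operatorname{inv}_k(\pi)}$, and $I(n,k,i)=[x^i]H_{n,k}(x)$ is the number of $\pi\in S_n$ with exactly $i$ $k$-step inversions. For $1\le i\le k$, the $i$-th $k$-step run of $\pi$ is the subsequence $\pi_i,\pi_{i+k},\pi_{i+2k},\dots$ of positions congruent to $i$ mod $k$, of length $\lfloor (n-i)/k\rfloor+1$. $A_\ell(x)=\sum_{\sigma\in S_\ell}x^{\operatorname{des}(\sigma)}$ is the $\ell$-th Eulerian polynomial, where $\operatorname{des}(\sigma)$ is the number of $i$ with $\sigma_i>\sigma_{i+1}$ (so $A_0=A_1=1$). -}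

module Defs where

open import Data.Nat using (ℕ; zero; suc; _+_; _*_; _∸_; _<_; _<?_; NonZero)
open import Data.Nat.DivMod using (_/_; _%_)
open import Data.Nat.Combinatorics using (_C_)
open import Data.Fin using (Fin; toℕ; fromℕ<)
open import Data.Fin.Properties using (_≟_)
open import Data.List using (List; []; _∷_; [_]; map; concatMap; filter; length; foldr; upTo)
open import Data.Nat.ListAction using (sum; product)
open import Data.List.Relation.Unary.AllPairs using (allPairs?)
open import Data.Vec using (Vec; []; _∷_; lookup; toList)
open import Data.Bool using (if_then_else_)
open import Relation.Nullary using (¬?; does)

-- A permutation π ∈ S_n is encoded as its one-line notation
-- (π(1),…,π(n)), a vector of n pairwise distinct elements of Fin n
-- (positions and values are 0-indexed: position a ↔ a+1 of the paper).

allVecs : (n m : ℕ) → List (Vec (Fin n) m)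
allVecs n zero    = [ [] ]
allVecs n (suc m) = concatMap (λ x → map (x ∷_) (allVecs n m)) (Data.List.allFin n)
  where import Data.List

perms : (n : ℕ) → List (Vec (Fin n) n)
perms n = filter (λ v → allPairs? (λ x y → ¬? (x ≟ y)) (toList v)) (allVecs n n)

kInvAt : {n : ℕ} → ℕ → Vec (Fin n) n → Fin n → ℕ
kInvAt {n} k π a with toℕ a + k <? n
... | Relation.Nullary.yes p =
      if does (toℕ (lookup π (fromℕ< p)) <? toℕ (lookup π a)) then 1 else 0
  where import Relation.Nullary
... | Relation.Nullary.no _ = 0
  where import Relation.Nullary

invₖ : {n : ℕ} → ℕ → Vec (Fin n) n → ℕ
invₖ {n} k π = sum (map (kInvAt k π) (Data.List.allFin n))
  where import Data.List

countℕ : {A : Set} → (A → ℕ) → ℕ → List A → ℕ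
countℕ f i xs = length (filter (λ x → f x Data.Nat.≟ i) xs)
  where import Data.Nat

-- I(n,k,i) = [x^i] H_{n,k}(x) = #{π ∈ S_n : inv_k(π) = i}
I : ℕ → ℕ → ℕ → ℕ
I n k i = countℕ (invₖ k) i (perms n)

-- Polynomials with ℕ coefficients as ascending coefficient lists.

Poly : Set
Poly = List ℕ

coeff : Poly → ℕ → ℕ
coeff []       _       = 0
coeff (c ∷ p)  zero    = c
coeff (c ∷ p)  (suc i) = coeff p i

_⊕_ : Poly → Poly → Poly
[]      ⊕ q       = q
(a ∷ p) ⊕ []      = a ∷ p
(a ∷ p) ⊕ (b ∷ q) = (a + b) ∷ (p ⊕ q)

scale : ℕ → Poly → Poly
scale c = map (c *_)

_⊗_ : Poly → Poly → Poly
[]      ⊗ q = []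
(a ∷ p) ⊗ q = scale a q ⊕ (0 ∷ (p ⊗ q))

_^ₚ_ : Poly → ℕ → Poly
p ^ₚ zero  = 1 ∷ []
p ^ₚ suc m = p ⊗ (p ^ₚ m)

desList : List ℕ → ℕ
desList []           = 0
desList (x ∷ [])     = 0
desList (x ∷ y ∷ xs) = (if does (y <? x) then 1 else 0) + desList (y ∷ xs)

des : {ℓ : ℕ} → Vec (Fin ℓ) ℓ → ℕ
des σ = desList (map toℕ (toList σ))

-- A_ℓ(x) = Σ_{σ ∈ S_ℓ} x^{des σ}; coefficients listed for degrees 0..ℓ
-- (des σ ≤ ℓ - 1, so all coefficients are captured; A_0 = A_1 = 1).
A : ℕ → Poly
A ℓ = map (λ d → countℕ des d (perms ℓ)) (upTo (suc ℓ))

runLen : (n k : ℕ) → .{{NonZero k}} → ℕ → ℕ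
runLen n k zero        = 0
runLen n k j@(suc _)   = (n ∸ j) / k + 1

runSum : (n k : ℕ) → .{{NonZero k}} → ℕ → ℕ
runSum n k j = sum (map (runLen n k) (upTo j))

I0formula : (n k : ℕ) → .{{NonZero k}} → ℕ
I0formula n k = product
  (map (λ j → (n ∸ runSum n k j) C runLen n k j)
       (map suc (upTo (k ∸ 1))))

-- A k-step inversion of π is a descent inside one of its k-step runs. Cutting
-- π ∈ S_n into its k runs of lengths λ_1, …, λ_k, the choice of which values go to
-- which run is counted by the multinomial ∏_j C(n - λ_1 - … - λ_{j-1}, λ_j) = I(n,k,0),
-- and since the descents of a run depend only on the relative order of its entries,
-- the runs contribute independent factors A_{λ_j}(x). Finally t = n mod k of the λ_j
-- equal ⌊n/k⌋ + 1 and the other k - t equal ⌊n/k⌋. All counts are carried out as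
-- sums over words, weighted by an indicator of distinctness.

module Submission where

open import Defs
open import Data.Nat using (ℕ; _+_; _∸_; _≤_; NonZero)
open import Data.Nat.DivMod using (_/_; _%_)
open import Data.Product using (_×_)
open import Relation.Binary.PropositionalEquality using (_≡_)

open import Algebra.Bundles using (CommutativeMonoid)
open import Data.Bool using (Bool; true; false; if_then_else_; not; _∧_)
open import Data.Bool.ListAction using (all)
open import Data.Bool.Properties using (∧-commutativeMonoid; ∧-zeroʳ; ∧-assoc)
open import Data.Fin using (Fin; toℕ; fromℕ<)
open import Data.Fin.Properties using (toℕ-fromℕ<) renaming (_≟_ to _≟ᶠ_)
open import Data.List
  using (List; []; _∷_; [_]; map; length; _++_; foldl; concat; concatMap; replicate;
         tabulate; allFin; filter; head; drop; applyUpTo)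
open import Data.List.Properties
  using (map-∘; map-cong; map-tabulate; map-++; length-map; drop-all; drop-[]; map-applyUpTo;
         applyUpTo-∷ʳ; ++-identityʳ; ++-assoc; length-replicate)
import Data.List.Relation.Binary.Permutation.Propositional as ↭
open ↭ using (_↭_)
open import Data.List.Relation.Binary.Permutation.Propositional.Properties using (++-comm)
open import Data.List.Relation.Unary.All using (All; []; _∷_)
import Data.List.Relation.Unary.All as All
open import Data.List.Relation.Unary.AllPairs using (allPairs?)
open import Data.List.Relation.Unary.Any using (Any; here; there)
open import Data.Maybe using (Maybe; just)
open import Data.Nat using (zero; suc; _*_; _<_; _>_; z≤n; s≤s; z<s; s<s; _≡ᵇ_; _<?_)
open import Data.Nat.Combinatorics using (_C_; nCn≡1; nCk+nC[k+1]≡[n+1]C[k+1])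
open import Data.Nat.DivMod
open import Data.Nat.ListAction using (sum; product)
open import Data.Nat.ListAction.Properties using (sum-++)
open import Data.Nat.Properties
open import Data.Nat.Tactic.RingSolver using (solve-∀)
open import Data.Product using (_,_)
open import Data.Sum using (_⊎_; inj₁; inj₂)
open import Data.Vec using (Vec; toList; lookup)
import Data.Vec as Vec
open import Data.Vec.Properties using (length-toList)
open import Function using (_∘_)
open import Function.Bundles using (mk⇔)
open import Relation.Binary.Core using (_Preserves_⟶_)
open import Relation.Binary.Definitions using (tri<; tri≈; tri>)
open import Relation.Binary.PropositionalEquality using (_≢_; refl; sym; trans; cong; cong₂; subst; module ≡-Reasoning)
open import Relation.Nullary using (Dec; does; ¬?; yes; no; contradiction)
open import Relation.Nullary.Decidable using (does-⇔)

open import Algebra.Properties.CommutativeSemigroup +-commutativeSemigroup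
  using () renaming (interchange to +-interchange; x∙yz≈y∙xz to +-left-comm; x∙yz≈xz∙y to +-right-comm)
open import Algebra.Properties.CommutativeSemigroup *-commutativeSemigroup
  using () renaming (interchange to *-interchange; x∙yz≈y∙xz to *-left-comm)
open import Algebra.Properties.CommutativeSemigroup (CommutativeMonoid.commutativeSemigroup ∧-commutativeMonoid)
  using () renaming (interchange to ∧-interchange; x∙yz≈y∙xz to ∧-left-comm)
open ≡-Reasoning

∑ : ℕ → (ℕ → ℕ) → ℕ
∑ zero    f = 0
∑ (suc n) f = f 0 + ∑ n (f ∘ suc)

∑-cong : ∀ n {f g : ℕ → ℕ} → (∀ x → x < n → f x ≡ g x) → ∑ n f ≡ ∑ n g
∑-cong zero    eq = refl
∑-cong (suc n) eq = cong₂ _+_ (eq 0 z<s) (∑-cong n (λ x x<n → eq (suc x) (s<s x<n)))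

∑-zero : ∀ n → ∑ n (λ _ → 0) ≡ 0
∑-zero zero    = refl
∑-zero (suc n) = ∑-zero n

∑-distrib-+ : ∀ n (f g : ℕ → ℕ) → ∑ n (λ x → f x + g x) ≡ ∑ n f + ∑ n g
∑-distrib-+ zero    f g = refl
∑-distrib-+ (suc n) f g = begin
  f 0 + g 0 + ∑ n (λ x → f (suc x) + g (suc x))   ≡⟨ cong (f 0 + g 0 +_) (∑-distrib-+ n (f ∘ suc) (g ∘ suc)) ⟩
  f 0 + g 0 + (∑ n (f ∘ suc) + ∑ n (g ∘ suc))     ≡⟨ +-interchange (f 0) (g 0) _ _ ⟩
  f 0 + ∑ n (f ∘ suc) + (g 0 + ∑ n (g ∘ suc))     ∎

∑-*ˡ : ∀ n c (f : ℕ → ℕ) → ∑ n (λ x → c * f x) ≡ c * ∑ n f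
∑-*ˡ zero    c f = sym (*-zeroʳ c)
∑-*ˡ (suc n) c f = trans (cong (c * f 0 +_) (∑-*ˡ n c (f ∘ suc))) (sym (*-distribˡ-+ c (f 0) _))

∑-comm : ∀ n m (f : ℕ → ℕ → ℕ) → ∑ n (λ x → ∑ m (f x)) ≡ ∑ m (λ y → ∑ n (λ x → f x y))
∑-comm zero    m f = sym (∑-zero m)
∑-comm (suc n) m f = begin
  ∑ m (f 0) + ∑ n (λ x → ∑ m (f (suc x)))           ≡⟨ cong (∑ m (f 0) +_) (∑-comm n m (f ∘ suc)) ⟩
  ∑ m (f 0) + ∑ m (λ y → ∑ n (λ x → f (suc x) y))   ≡⟨ sym (∑-distrib-+ m _ _) ⟩
  ∑ m (λ y → f 0 y + ∑ n (λ x → f (suc x) y))       ∎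

∑-if : ∀ n b (f : ℕ → ℕ) → ∑ n (λ x → if b then f x else 0) ≡ (if b then ∑ n f else 0)
∑-if n true  f = refl
∑-if n false f = ∑-zero n

∑-if-zero : ∀ n (b : ℕ → Bool) → ∑ n (λ x → if b x then 0 else 0) ≡ 0
∑-if-zero n b = trans (∑-cong n (λ x _ → if-zero (b x))) (∑-zero n)
  where
  if-zero : ∀ c → (if c then 0 else 0) ≡ 0
  if-zero true  = refl
  if-zero false = refl

if-* : ∀ b a c → (if b then a else 0) * c ≡ (if b then a * c else 0)
if-* true  a c = refl
if-* false a c = refl

∑-if-regroup : ∀ N b₀ (b : ℕ → Bool) (W Z : ℕ → ℕ) B {S} → S ≡ ∑ N (λ x → if b x then Z x else 0) →
  (if b₀ then B + 0 else 0) + ∑ N (λ x → if b x then W x + (if b₀ then Z x else 0) else 0)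
  ≡ ∑ N (λ x → if b x then W x else 0) + (if b₀ then B + S else 0)
∑-if-regroup N false b W Z B eq = trans (∑-cong N (λ x _ → drop-+0 (b x) (W x))) (sym (+-identityʳ _))
  where
  drop-+0 : ∀ c a → (if c then a + 0 else 0) ≡ (if c then a else 0)
  drop-+0 true  a = +-identityʳ a
  drop-+0 false a = refl
∑-if-regroup N true  b W Z B {S} eq = begin
  B + 0 + ∑ N (λ x → if b x then W x + Z x else 0)
    ≡⟨ cong₂ _+_ (+-identityʳ B) (∑-cong N (λ x _ → split-if (b x) (W x) (Z x))) ⟩
  B + ∑ N (λ x → (if b x then W x else 0) + (if b x then Z x else 0))
    ≡⟨ cong (B +_) (trans (∑-distrib-+ N _ _) (cong (_ +_) (sym eq))) ⟩
  B + (∑ N (λ x → if b x then W x else 0) + S)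
    ≡⟨ +-left-comm B _ S ⟩
  ∑ N (λ x → if b x then W x else 0) + (B + S) ∎
  where
  split-if : ∀ c a r → (if c then a + r else 0) ≡ (if c then a else 0) + (if c then r else 0)
  split-if true  a r = refl
  split-if false a r = refl

∑ʷ : ℕ → ℕ → (List ℕ → ℕ) → ℕ
∑ʷ N zero    g = g []
∑ʷ N (suc m) g = ∑ N (λ x → ∑ʷ N m (g ∘ (x ∷_)))

Word : ℕ → ℕ → List ℕ → Set
Word N m w = length w ≡ m × All (_< N) w

∑ʷ-cong-on : ∀ N m {g h : List ℕ → ℕ} → (∀ w → Word N m w → g w ≡ h w) → ∑ʷ N m g ≡ ∑ʷ N m h
∑ʷ-cong-on N zero    eq = eq [] (refl , [])
∑ʷ-cong-on N (suc m) eq =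
  ∑-cong N (λ x x<N → ∑ʷ-cong-on N m (λ w (len , bnd) → eq (x ∷ w) (cong suc len , x<N ∷ bnd)))

∑ʷ-cong : ∀ N m {g h : List ℕ → ℕ} → (∀ w → g w ≡ h w) → ∑ʷ N m g ≡ ∑ʷ N m h
∑ʷ-cong N m eq = ∑ʷ-cong-on N m (λ w _ → eq w)

∑ʷ-zero : ∀ N m → ∑ʷ N m (λ _ → 0) ≡ 0
∑ʷ-zero N zero    = refl
∑ʷ-zero N (suc m) = trans (∑-cong N (λ _ _ → ∑ʷ-zero N m)) (∑-zero N)

∑ʷ-*ˡ : ∀ N m c (g : List ℕ → ℕ) → ∑ʷ N m (λ w → c * g w) ≡ c * ∑ʷ N m g
∑ʷ-*ˡ N zero    c g = refl
∑ʷ-*ˡ N (suc m) c g = trans (∑-cong N (λ x _ → ∑ʷ-*ˡ N m c (g ∘ (x ∷_)))) (∑-*ˡ N c _)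

∑ʷ-*ʳ : ∀ N m c (g : List ℕ → ℕ) → ∑ʷ N m (λ w → g w * c) ≡ ∑ʷ N m g * c
∑ʷ-*ʳ N m c g = trans (∑ʷ-cong N m (λ w → *-comm (g w) c)) (trans (∑ʷ-*ˡ N m c g) (*-comm c _))

∑-∑ʷ-comm : ∀ K N m (f : ℕ → List ℕ → ℕ) → ∑ K (λ d → ∑ʷ N m (f d)) ≡ ∑ʷ N m (λ w → ∑ K (λ d → f d w))
∑-∑ʷ-comm K N zero    f = refl
∑-∑ʷ-comm K N (suc m) f = begin
  ∑ K (λ d → ∑ N (λ x → ∑ʷ N m (λ w → f d (x ∷ w))))   ≡⟨ ∑-comm K N _ ⟩
  ∑ N (λ x → ∑ K (λ d → ∑ʷ N m (λ w → f d (x ∷ w))))   ≡⟨ ∑-cong N (λ x _ → ∑-∑ʷ-comm K N m _) ⟩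
  ∑ N (λ x → ∑ʷ N m (λ w → ∑ K (λ d → f d (x ∷ w))))   ∎

∑ʷ-comm : ∀ N a b (f : List ℕ → List ℕ → ℕ) →
  ∑ʷ N a (λ u → ∑ʷ N b (f u)) ≡ ∑ʷ N b (λ v → ∑ʷ N a (λ u → f u v))
∑ʷ-comm N zero    b f = refl
∑ʷ-comm N (suc a) b f = begin
  ∑ N (λ x → ∑ʷ N a (λ u → ∑ʷ N b (f (x ∷ u))))          ≡⟨ ∑-cong N (λ x _ → ∑ʷ-comm N a b _) ⟩
  ∑ N (λ x → ∑ʷ N b (λ v → ∑ʷ N a (λ u → f (x ∷ u) v)))  ≡⟨ ∑-∑ʷ-comm N N b _ ⟩
  ∑ʷ N b (λ v → ∑ N (λ x → ∑ʷ N a (λ u → f (x ∷ u) v)))  ∎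

∑ʷ-if : ∀ N m b (f : List ℕ → ℕ) → ∑ʷ N m (λ w → if b then f w else 0) ≡ (if b then ∑ʷ N m f else 0)
∑ʷ-if N m true  f = refl
∑ʷ-if N m false f = ∑ʷ-zero N m

-- Distinct words over a set of available letters

Avail : Set
Avail = ℕ → Bool

allAvail : Avail
allAvail _ = true

_∖_ : Avail → ℕ → Avail
(av ∖ x) y = if y ≡ᵇ x then false else av y

distinctIn : Avail → List ℕ → ℕ
distinctIn av []      = 1
distinctIn av (x ∷ w) = if av x then distinctIn (av ∖ x) w else 0

card : ℕ → Avail → ℕ
card zero    av = 0
card (suc N) av = if av 0 then suc (card N (av ∘ suc)) else card N (av ∘ suc)

insertAt : ℕ → ℕ → List ℕ → List ℕ
insertAt zero    a w       = a ∷ w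
insertAt (suc p) a []      = a ∷ []
insertAt (suc p) a (x ∷ w) = x ∷ insertAt p a w

-- Every permutation of {0,…,m} arises exactly once by inserting 0 at one of
-- m+1 positions into the shift of a permutation of {0,…,m-1}.
∑ᵖ : ℕ → (List ℕ → ℕ) → ℕ
∑ᵖ zero    G = G []
∑ᵖ (suc m) G = ∑ (suc m) (λ p → ∑ᵖ m (λ w → G (insertAt p 0 (map suc w))))

∑ᵖ-cong : ∀ m {G H : List ℕ → ℕ} → (∀ w → G w ≡ H w) → ∑ᵖ m G ≡ ∑ᵖ m H
∑ᵖ-cong zero    eq = eq []
∑ᵖ-cong (suc m) eq = ∑-cong (suc m) (λ p _ → ∑ᵖ-cong m (λ w → eq (insertAt p 0 (map suc w))))

-- G summed over the distinct available words of length m over {0,…,N} that contain 0,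
-- by the position of 0
∑ʷ∋0 : ℕ → Avail → ℕ → (List ℕ → ℕ) → ℕ
∑ʷ∋0 N av zero    G = 0
∑ʷ∋0 N av (suc m) G = ∑ (suc m) (λ p → ∑ʷ N m (λ v → distinctIn (av ∘ suc) v * G (insertAt p 0 (map suc v))))

∑ʷ-distinctIn-∷ : ∀ N m av x (H : List ℕ → ℕ) →
  ∑ʷ N m (λ v → distinctIn av (x ∷ v) * H v) ≡ (if av x then ∑ʷ N m (λ v → distinctIn (av ∖ x) v * H v) else 0)
∑ʷ-distinctIn-∷ N m av x H = trans (∑ʷ-cong N m (λ v → if-* (av x) _ _)) (∑ʷ-if N m (av x) _)

-- the words containing 0 but not starting with it, by their first letter
∑ʷ∋0-suc : ∀ N m av (G : List ℕ → ℕ) →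
  ∑ m (λ p → ∑ʷ N m (λ v → distinctIn (av ∘ suc) v * G (insertAt (suc p) 0 (map suc v))))
  ≡ ∑ N (λ x → if av (suc x) then ∑ʷ∋0 N (av ∖ suc x) m (G ∘ (suc x ∷_)) else 0)
∑ʷ∋0-suc N zero    av G = sym (∑-if-zero N (av ∘ suc))
∑ʷ∋0-suc N (suc m) av G = begin
  ∑ (suc m) (λ p → ∑ N (λ x → ∑ʷ N m (λ v → distinctIn (av ∘ suc) (x ∷ v) * H x p v)))
    ≡⟨ ∑-cong (suc m) (λ p _ → ∑-cong N (λ x _ → ∑ʷ-distinctIn-∷ N m (av ∘ suc) x (H x p))) ⟩
  ∑ (suc m) (λ p → ∑ N (λ x → if av (suc x) then S x p else 0))
    ≡⟨ ∑-comm (suc m) N (λ p x → if av (suc x) then S x p else 0) ⟩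
  ∑ N (λ x → ∑ (suc m) (λ p → if av (suc x) then S x p else 0))
    ≡⟨ ∑-cong N (λ x _ → ∑-if (suc m) (av (suc x)) (S x)) ⟩
  ∑ N (λ x → if av (suc x) then ∑ʷ∋0 N (av ∖ suc x) (suc m) (G ∘ (suc x ∷_)) else 0) ∎
  where
  H : ℕ → ℕ → List ℕ → ℕ
  H x p v = G (suc x ∷ insertAt p 0 (map suc v))
  S : ℕ → ℕ → ℕ
  S x p = ∑ʷ N m (λ v → distinctIn ((av ∘ suc) ∖ x) v * H x p v)

∑ʷ-split0 : ∀ N m av (G : List ℕ → ℕ) →
  ∑ʷ (suc N) m (λ v → distinctIn av v * G v)
  ≡ ∑ʷ N m (λ v → distinctIn (av ∘ suc) v * G (map suc v)) + (if av 0 then ∑ʷ∋0 N av m G else 0)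
∑ʷ-split0 N zero av G with av 0
... | true  = sym (+-identityʳ _)
... | false = sym (+-identityʳ _)
∑ʷ-split0 N (suc m) av G = begin
  ∑ʷ (suc N) m (λ v → distinctIn av (0 ∷ v) * G (0 ∷ v))
    + ∑ N (λ x → ∑ʷ (suc N) m (λ v → distinctIn av (suc x ∷ v) * G (suc x ∷ v)))
    ≡⟨ cong₂ _+_ first0 (∑-cong N (λ x _ → firstSuc x)) ⟩
  (if av 0 then B₀ + 0 else 0) + ∑ N (λ x → if av (suc x) then W x + (if av 0 then Z x else 0) else 0)
    ≡⟨ ∑-if-regroup N (av 0) (av ∘ suc) W Z B₀ (∑ʷ∋0-suc N m av G) ⟩
  ∑ N (λ x → if av (suc x) then W x else 0) + (if av 0 then ∑ʷ∋0 N av (suc m) G else 0)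
    ≡⟨ cong (_+ (if av 0 then ∑ʷ∋0 N av (suc m) G else 0))
         (sym (∑-cong N (λ x _ → ∑ʷ-distinctIn-∷ N m (av ∘ suc) x (G ∘ (suc x ∷_) ∘ map suc)))) ⟩
  ∑ʷ N (suc m) (λ v → distinctIn (av ∘ suc) v * G (map suc v)) + (if av 0 then ∑ʷ∋0 N av (suc m) G else 0) ∎
  where
  B₀ : ℕ
  B₀ = ∑ʷ N m (λ v → distinctIn (av ∘ suc) v * G (0 ∷ map suc v))
  W Z : ℕ → ℕ
  W x = ∑ʷ N m (λ v → distinctIn ((av ∖ suc x) ∘ suc) v * G (suc x ∷ map suc v))
  Z x = ∑ʷ∋0 N (av ∖ suc x) m (G ∘ (suc x ∷_))

  first0 : ∑ʷ (suc N) m (λ v → distinctIn av (0 ∷ v) * G (0 ∷ v)) ≡ (if av 0 then B₀ + 0 else 0)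
  first0 = trans (∑ʷ-distinctIn-∷ (suc N) m av 0 _)
                 (cong (λ z → if av 0 then z else 0) (∑ʷ-split0 N m (av ∖ 0) (G ∘ (0 ∷_))))

  firstSuc : ∀ x → ∑ʷ (suc N) m (λ v → distinctIn av (suc x ∷ v) * G (suc x ∷ v))
                   ≡ (if av (suc x) then W x + (if av 0 then Z x else 0) else 0)
  firstSuc x = trans (∑ʷ-distinctIn-∷ (suc N) m av (suc x) _)
                     (cong (λ z → if av (suc x) then z else 0) (∑ʷ-split0 N m (av ∖ suc x) (G ∘ (suc x ∷_))))


OrderInvariant : (List ℕ → ℕ) → Set
OrderInvariant G = ∀ f → f Preserves _<_ ⟶ _<_ → ∀ w → G (map f w) ≡ G w

map-insertAt : ∀ (f : ℕ → ℕ) p a w → map f (insertAt p a w) ≡ insertAt p (f a) (map f w)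
map-insertAt f zero    a w       = refl
map-insertAt f (suc p) a []      = refl
map-insertAt f (suc p) a (x ∷ w) = cong (f x ∷_) (map-insertAt f p a w)

orderInvariant-∘suc : ∀ {G} → OrderInvariant G → OrderInvariant (G ∘ map suc)
orderInvariant-∘suc {G} inv f f-mono w = begin
  G (map suc (map f w))   ≡⟨ cong G (sym (map-∘ w)) ⟩
  G (map (suc ∘ f) w)     ≡⟨ inv (suc ∘ f) (s<s ∘ f-mono) w ⟩
  G w                     ≡⟨ sym (inv suc s<s w) ⟩
  G (map suc w)           ∎

lift0 : (ℕ → ℕ) → ℕ → ℕ
lift0 f zero    = zero
lift0 f (suc x) = suc (f x)

lift0-mono : ∀ {f} → f Preserves _<_ ⟶ _<_ → lift0 f Preserves _<_ ⟶ _<_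
lift0-mono f-mono {zero}  {suc y} _         = z<s
lift0-mono f-mono {suc x} {suc y} (s<s x<y) = s<s (f-mono x<y)

orderInvariant-insert0 : ∀ {G} p → OrderInvariant G → OrderInvariant (λ w → G (insertAt p 0 (map suc w)))
orderInvariant-insert0 {G} p inv f f-mono w = begin
  G (insertAt p 0 (map suc (map f w)))          ≡⟨ cong (λ z → G (insertAt p 0 z)) (trans (sym (map-∘ w)) (map-∘ w)) ⟩
  G (insertAt p 0 (map (lift0 f) (map suc w)))  ≡⟨ cong G (sym (map-insertAt (lift0 f) p 0 (map suc w))) ⟩
  G (map (lift0 f) (insertAt p 0 (map suc w)))  ≡⟨ inv (lift0 f) (lift0-mono f-mono) _ ⟩
  G (insertAt p 0 (map suc w))                  ∎

-- An order-invariant statistic only sees the standardisation of a word; a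
-- distinct word of length m is a choice of m available letters and a permutation.
∑ʷ-distinctIn : ∀ N av m G → OrderInvariant G →
  ∑ʷ N m (λ v → distinctIn av v * G v) ≡ (card N av C m) * ∑ᵖ m G
∑ʷ-distinctIn zero    av zero    G inv = refl
∑ʷ-distinctIn zero    av (suc m) G inv = refl
∑ʷ-distinctIn (suc N) av m       G inv = begin
  ∑ʷ (suc N) m (λ v → distinctIn av v * G v)
    ≡⟨ ∑ʷ-split0 N m av G ⟩
  ∑ʷ N m (λ v → distinctIn (av ∘ suc) v * G (map suc v)) + (if av 0 then ∑ʷ∋0 N av m G else 0)
    ≡⟨ cong (_+ (if av 0 then ∑ʷ∋0 N av m G else 0)) avoiding0 ⟩
  (c C m) * ∑ᵖ m G + (if av 0 then ∑ʷ∋0 N av m G else 0)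
    ≡⟨ pascal (av 0) m ⟩
  (card (suc N) av C m) * ∑ᵖ m G ∎
  where
  c = card N (av ∘ suc)

  avoiding0 : ∑ʷ N m (λ v → distinctIn (av ∘ suc) v * G (map suc v)) ≡ (c C m) * ∑ᵖ m G
  avoiding0 = trans (∑ʷ-distinctIn N (av ∘ suc) m (G ∘ map suc) (orderInvariant-∘suc inv))
                    (cong ((c C m) *_) (∑ᵖ-cong m (inv suc s<s)))

  containing0 : ∀ j → ∑ʷ∋0 N av (suc j) G ≡ (c C j) * ∑ᵖ (suc j) G
  containing0 j = trans
    (∑-cong (suc j) (λ p _ → ∑ʷ-distinctIn N (av ∘ suc) j _ (orderInvariant-insert0 p inv)))
    (∑-*ˡ (suc j) (c C j) (λ p → ∑ᵖ j (λ w → G (insertAt p 0 (map suc w)))))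

  pascal : ∀ b j → (c C j) * ∑ᵖ j G + (if b then ∑ʷ∋0 N av j G else 0) ≡ ((if b then suc c else c) C j) * ∑ᵖ j G
  pascal false j       = +-identityʳ _
  pascal true  zero    = +-identityʳ _
  pascal true  (suc j) = begin
    (c C suc j) * ∑ᵖ (suc j) G + ∑ʷ∋0 N av (suc j) G
      ≡⟨ cong ((c C suc j) * ∑ᵖ (suc j) G +_) (containing0 j) ⟩
    (c C suc j) * ∑ᵖ (suc j) G + (c C j) * ∑ᵖ (suc j) G
      ≡⟨ *-distribʳ-+ (∑ᵖ (suc j) G) (c C suc j) _ ⟨
    (c C suc j + c C j) * ∑ᵖ (suc j) G
      ≡⟨ cong (_* ∑ᵖ (suc j) G) (trans (+-comm (c C suc j) _) (nCk+nC[k+1]≡[n+1]C[k+1] c j)) ⟩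
    (suc c C suc j) * ∑ᵖ (suc j) G ∎

𝟙 : Bool → ℕ
𝟙 true  = 1
𝟙 false = 0

distinct : List ℕ → Bool
distinct []      = true
distinct (x ∷ w) = all (λ y → not (y ≡ᵇ x)) w ∧ distinct w

all-∖ : ∀ av x w → all (av ∖ x) w ≡ all av w ∧ all (λ y → not (y ≡ᵇ x)) w
all-∖ av x []      = refl
all-∖ av x (y ∷ w) rewrite all-∖ av x w = regroup (y ≡ᵇ x) (av y) (all av w) _
  where
  regroup : ∀ b a r s → (if b then false else a) ∧ (r ∧ s) ≡ (a ∧ r) ∧ (not b ∧ s)
  regroup true  a     r s = sym (∧-zeroʳ _)
  regroup false true  r s = refl
  regroup false false r s = refl

distinctIn-char : ∀ av w → distinctIn av w ≡ 𝟙 (all av w ∧ distinct w)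
distinctIn-char av []      = refl
distinctIn-char av (x ∷ w) with av x
... | false = refl
... | true  = trans (distinctIn-char (av ∖ x) w)
                    (cong 𝟙 (trans (cong (_∧ distinct w) (all-∖ av x w)) (∧-assoc (all av w) _ _)))

all-resp-↭ : ∀ (p : ℕ → Bool) {w w′} → w ↭ w′ → all p w ≡ all p w′
all-resp-↭ p ↭.refl           = refl
all-resp-↭ p (↭.prep x σ)     = cong (p x ∧_) (all-resp-↭ p σ)
all-resp-↭ p (↭.swap x y σ)   = trans (cong (λ r → p x ∧ (p y ∧ r)) (all-resp-↭ p σ)) (∧-left-comm (p x) (p y) _)
all-resp-↭ p (↭.trans σ σ′)   = trans (all-resp-↭ p σ) (all-resp-↭ p σ′)

≡ᵇ-sym : ∀ x y → (x ≡ᵇ y) ≡ (y ≡ᵇ x)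
≡ᵇ-sym zero    zero    = refl
≡ᵇ-sym zero    (suc y) = refl
≡ᵇ-sym (suc x) zero    = refl
≡ᵇ-sym (suc x) (suc y) = ≡ᵇ-sym x y

distinct-resp-↭ : ∀ {w w′} → w ↭ w′ → distinct w ≡ distinct w′
distinct-resp-↭ ↭.refl         = refl
distinct-resp-↭ (↭.prep x σ)   = cong₂ _∧_ (all-resp-↭ _ σ) (distinct-resp-↭ σ)
distinct-resp-↭ {x ∷ y ∷ w} {_ ∷ _ ∷ w′} (↭.swap x y σ) = begin
  (not (y ≡ᵇ x) ∧ all (λ z → not (z ≡ᵇ x)) w) ∧ (all (λ z → not (z ≡ᵇ y)) w ∧ distinct w)
    ≡⟨ ∧-interchange (not (y ≡ᵇ x)) (all (λ z → not (z ≡ᵇ x)) w) (all (λ z → not (z ≡ᵇ y)) w) (distinct w) ⟩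
  (not (y ≡ᵇ x) ∧ all (λ z → not (z ≡ᵇ y)) w) ∧ (all (λ z → not (z ≡ᵇ x)) w ∧ distinct w)
    ≡⟨ cong₂ _∧_ (cong₂ _∧_ (cong not (≡ᵇ-sym y x)) (all-resp-↭ _ σ))
                 (cong₂ _∧_ (all-resp-↭ _ σ) (distinct-resp-↭ σ)) ⟩
  (not (x ≡ᵇ y) ∧ all (λ z → not (z ≡ᵇ y)) w′) ∧ (all (λ z → not (z ≡ᵇ x)) w′ ∧ distinct w′) ∎
distinct-resp-↭ (↭.trans σ σ′) = trans (distinct-resp-↭ σ) (distinct-resp-↭ σ′)

distinctIn-resp-↭ : ∀ av {w w′} → w ↭ w′ → distinctIn av w ≡ distinctIn av w′
distinctIn-resp-↭ av {w} {w′} σ = begin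
  distinctIn av w               ≡⟨ distinctIn-char av w ⟩
  𝟙 (all av w ∧ distinct w)     ≡⟨ cong 𝟙 (cong₂ _∧_ (all-resp-↭ av σ) (distinct-resp-↭ σ)) ⟩
  𝟙 (all av w′ ∧ distinct w′)   ≡⟨ sym (distinctIn-char av w′) ⟩
  distinctIn av w′              ∎

removeAll : Avail → List ℕ → Avail
removeAll = foldl _∖_

distinctIn-++ : ∀ av u v → distinctIn av (u ++ v) ≡ distinctIn av u * distinctIn (removeAll av u) v
distinctIn-++ av []      v = sym (+-identityʳ _)
distinctIn-++ av (x ∷ u) v with av x
... | true  = distinctIn-++ (av ∖ x) u v
... | false = refl

card-allAvail : ∀ N → card N allAvail ≡ N
card-allAvail zero    = refl
card-allAvail (suc N) = cong suc (card-allAvail N)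

card-∖ : ∀ N av x → x < N → av x ≡ true → suc (card N (av ∖ x)) ≡ card N av
card-∖ (suc N) av zero    x<N       avx rewrite avx = refl
card-∖ (suc N) av (suc x) (s<s x<N) avx with av 0
... | true  = cong suc (card-∖ N (av ∘ suc) x x<N avx)
... | false = card-∖ N (av ∘ suc) x x<N avx

card-removeAll : ∀ N av u → distinctIn av u ≡ 1 → All (_< N) u → card N (removeAll av u) + length u ≡ card N av
card-removeAll N av []      _ _ = +-identityʳ _
card-removeAll N av (x ∷ u) dist (x<N ∷ u<N) with av x in avx
... | true  = begin
  card N (removeAll (av ∖ x) u) + suc (length u)   ≡⟨ +-suc _ _ ⟩
  suc (card N (removeAll (av ∖ x) u) + length u)   ≡⟨ cong suc (card-removeAll N (av ∖ x) u dist u<N) ⟩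
  suc (card N (av ∖ x))                             ≡⟨ card-∖ N av x x<N avx ⟩
  card N av                                         ∎

word : ∀ {N m} → Vec (Fin N) m → List ℕ
word v = map toℕ (toList v)

countℕ-filter : ∀ {X : Set} {P : X → Set} (P? : ∀ x → Dec (P x)) (f : X → ℕ) i xs →
  countℕ f i (filter P? xs) ≡ sum (map (λ x → 𝟙 (does (P? x)) * 𝟙 (f x ≡ᵇ i)) xs)
countℕ-filter P? f i [] = refl
countℕ-filter P? f i (x ∷ xs) with does (P? x)
... | false = countℕ-filter P? f i xs
... | true with f x ≡ᵇ i
...   | true  = cong suc (countℕ-filter P? f i xs)
...   | false = countℕ-filter P? f i xs

sum-tabulate : ∀ N (F : ℕ → ℕ) → sum (tabulate {n = N} (F ∘ toℕ)) ≡ ∑ N F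
sum-tabulate zero    F = refl
sum-tabulate (suc N) F = cong (F 0 +_) (sum-tabulate N (F ∘ suc))

sum-allFin : ∀ N (F : ℕ → ℕ) → sum (map (F ∘ toℕ) (allFin N)) ≡ ∑ N F
sum-allFin N F = trans (cong sum (map-tabulate {n = N} (λ i → i) (F ∘ toℕ))) (sum-tabulate N F)

sum-concatMap : ∀ {X Y : Set} (F : X → List Y) (h : Y → ℕ) xs →
  sum (map h (concatMap F xs)) ≡ sum (map (λ x → sum (map h (F x))) xs)
sum-concatMap F h []       = refl
sum-concatMap F h (x ∷ xs) = begin
  sum (map h (F x ++ concatMap F xs))               ≡⟨ cong sum (map-++ h (F x) _) ⟩
  sum (map h (F x) ++ map h (concatMap F xs))       ≡⟨ sum-++ (map h (F x)) _ ⟩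
  sum (map h (F x)) + sum (map h (concatMap F xs))  ≡⟨ cong (sum (map h (F x)) +_) (sum-concatMap F h xs) ⟩
  sum (map h (F x)) + sum (map (λ x → sum (map h (F x))) xs) ∎

sum-allVecs : ∀ N m (g : List ℕ → ℕ) → sum (map (g ∘ word) (allVecs N m)) ≡ ∑ʷ N m g
sum-allVecs N zero    g = +-identityʳ _
sum-allVecs N (suc m) g = begin
  sum (map (g ∘ word) (concatMap (λ x → map (x Vec.∷_) (allVecs N m)) (allFin N)))
    ≡⟨ sum-concatMap (λ x → map (x Vec.∷_) (allVecs N m)) (g ∘ word) (allFin N) ⟩
  sum (map (λ x → sum (map (g ∘ word) (map (x Vec.∷_) (allVecs N m)))) (allFin N))
    ≡⟨ cong sum (map-cong (λ x → trans (cong sum (sym (map-∘ (allVecs N m)))) (sum-allVecs N m (g ∘ (toℕ x ∷_)))) (allFin N)) ⟩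
  sum (map (λ x → ∑ʷ N m (g ∘ (toℕ x ∷_))) (allFin N))
    ≡⟨ sum-allFin N (λ x → ∑ʷ N m (g ∘ (x ∷_))) ⟩
  ∑ʷ N (suc m) g ∎

does-≟ᶠ : ∀ {N} (x y : Fin N) → does (x ≟ᶠ y) ≡ (toℕ x ≡ᵇ toℕ y)
does-≟ᶠ Fin.zero    Fin.zero    = refl
does-≟ᶠ Fin.zero    (Fin.suc y) = refl
does-≟ᶠ (Fin.suc x) Fin.zero    = refl
does-≟ᶠ (Fin.suc x) (Fin.suc y) = does-≟ᶠ x y

does-all-≢ : ∀ {N} (x : Fin N) l →
  does (All.all? (λ y → ¬? (x ≟ᶠ y)) l) ≡ all (λ y → not (y ≡ᵇ toℕ x)) (map toℕ l)
does-all-≢ x []      = refl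
does-all-≢ x (y ∷ l) = cong₂ _∧_ (cong not (trans (does-≟ᶠ x y) (≡ᵇ-sym (toℕ x) (toℕ y)))) (does-all-≢ x l)

does-allPairs-≢ : ∀ {N} (l : List (Fin N)) → does (allPairs? (λ x y → ¬? (x ≟ᶠ y)) l) ≡ distinct (map toℕ l)
does-allPairs-≢ []      = refl
does-allPairs-≢ (x ∷ l) = cong₂ _∧_ (does-all-≢ x l) (does-allPairs-≢ l)

all-allAvail : ∀ w → all allAvail w ≡ true
all-allAvail []      = refl
all-allAvail (x ∷ w) = all-allAvail w

distinctIn-allAvail : ∀ {N} (l : List (Fin N)) →
  distinctIn allAvail (map toℕ l) ≡ 𝟙 (does (allPairs? (λ x y → ¬? (x ≟ᶠ y)) l))
distinctIn-allAvail l = begin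
  distinctIn allAvail (map toℕ l)                               ≡⟨ distinctIn-char allAvail (map toℕ l) ⟩
  𝟙 (all allAvail (map toℕ l) ∧ distinct (map toℕ l))           ≡⟨ cong (λ b → 𝟙 (b ∧ distinct (map toℕ l))) (all-allAvail (map toℕ l)) ⟩
  𝟙 (distinct (map toℕ l))                                      ≡⟨ cong 𝟙 (sym (does-allPairs-≢ l)) ⟩
  𝟙 (does (allPairs? (λ x y → ¬? (x ≟ᶠ y)) l))                  ∎

countℕ-perms : ∀ n (f : List ℕ → ℕ) i →
  countℕ (f ∘ word) i (perms n) ≡ ∑ʷ n n (λ w → distinctIn allAvail w * 𝟙 (f w ≡ᵇ i))
countℕ-perms n f i = begin
  countℕ (f ∘ word) i (perms n)
    ≡⟨ countℕ-filter _ (f ∘ word) i (allVecs n n) ⟩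
  sum (map (λ v → 𝟙 (does (allPairs? (λ x y → ¬? (x ≟ᶠ y)) (toList v))) * 𝟙 (f (word v) ≡ᵇ i)) (allVecs n n))
    ≡⟨ cong sum (map-cong (λ v → cong (_* 𝟙 (f (word v) ≡ᵇ i)) (sym (distinctIn-allAvail (toList v)))) (allVecs n n)) ⟩
  sum (map (λ v → distinctIn allAvail (word v) * 𝟙 (f (word v) ≡ᵇ i)) (allVecs n n))
    ≡⟨ sum-allVecs n n (λ w → distinctIn allAvail w * 𝟙 (f w ≡ᵇ i)) ⟩
  ∑ʷ n n (λ w → distinctIn allAvail w * 𝟙 (f w ≡ᵇ i)) ∎

countℕ-cong : ∀ {X : Set} {f g : X → ℕ} → (∀ x → f x ≡ g x) → ∀ i xs → countℕ f i xs ≡ countℕ g i xs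
countℕ-cong f≗g i [] = refl
countℕ-cong {g = g} f≗g i (x ∷ xs) rewrite f≗g x with g x ≡ᵇ i
... | true  = cong suc (countℕ-cong f≗g i xs)
... | false = countℕ-cong f≗g i xs

descentᵐ : Maybe ℕ → Maybe ℕ → ℕ
descentᵐ (just x) (just y) = if does (y <? x) then 1 else 0
descentᵐ _        _        = 0

-- the inversions at distance suc k′ (so k′ = k - 1)
invʷ : ℕ → List ℕ → ℕ
invʷ k′ []      = 0
invʷ k′ (x ∷ w) = descentᵐ (just x) (head (drop k′ w)) + invʷ k′ w

length-word : ∀ {N m} (v : Vec (Fin N) m) → length (word v) ≡ m
length-word v = trans (length-map toℕ (toList v)) (length-toList v)

head-drop-word : ∀ {N m} (v : Vec (Fin N) m) (i : Fin m) → head (drop (toℕ i) (word v)) ≡ just (toℕ (lookup v i))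
head-drop-word (x Vec.∷ v) Fin.zero    = refl
head-drop-word (x Vec.∷ v) (Fin.suc i) = head-drop-word v i

kInvAt-descentᵐ : ∀ {n} k′ (π : Vec (Fin n) n) a →
  kInvAt (suc k′) π a ≡ descentᵐ (head (drop (toℕ a) (word π))) (head (drop (toℕ a + suc k′) (word π)))
kInvAt-descentᵐ {n} k′ π a rewrite head-drop-word π a with toℕ a + suc k′ <? n
... | yes a+k<n = cong (descentᵐ (just (toℕ (lookup π a)))) (sym (trans
  (cong (λ j → head (drop j (word π))) (sym (toℕ-fromℕ< a+k<n))) (head-drop-word π (fromℕ< a+k<n))))
... | no  a+k≮n = sym (cong (descentᵐ (just (toℕ (lookup π a))) ∘ head) (drop-all (toℕ a + suc k′) (word π) n≤a+k))
  where
  n≤a+k : length (word π) ≤ toℕ a + suc k′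
  n≤a+k = subst (_≤ toℕ a + suc k′) (sym (length-word π)) (≮⇒≥ a+k≮n)

∑-descentᵐ : ∀ k′ w → ∑ (length w) (λ a → descentᵐ (head (drop a w)) (head (drop (a + suc k′) w))) ≡ invʷ k′ w
∑-descentᵐ k′ []      = refl
∑-descentᵐ k′ (x ∷ w) = cong (descentᵐ (just x) (head (drop k′ w)) +_) (∑-descentᵐ k′ w)

invₖ-invʷ : ∀ {n} k′ (π : Vec (Fin n) n) → invₖ (suc k′) π ≡ invʷ k′ (word π)
invₖ-invʷ {n} k′ π = begin
  sum (map (kInvAt (suc k′) π) (allFin n))   ≡⟨ cong sum (map-cong (kInvAt-descentᵐ k′ π) (allFin n)) ⟩
  sum (map (descents ∘ toℕ) (allFin n))       ≡⟨ sum-allFin n descents ⟩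
  ∑ n descents                                ≡⟨ cong (λ L → ∑ L descents) (sym (length-word π)) ⟩
  ∑ (length (word π)) descents                ≡⟨ ∑-descentᵐ k′ (word π) ⟩
  invʷ k′ (word π)                            ∎
  where
  descents : ℕ → ℕ
  descents a = descentᵐ (head (drop a (word π))) (head (drop (a + suc k′) (word π)))

mono-reflects-< : ∀ {f} → f Preserves _<_ ⟶ _<_ → ∀ {a b} → f a < f b → a < b
mono-reflects-< f-mono {a} {b} fa<fb with <-cmp a b
... | tri< a<b _ _ = a<b
... | tri≈ _ refl _ = contradiction fa<fb (<-irrefl refl)
... | tri> _ _ b<a = contradiction (f-mono b<a) (<-asym fa<fb)

desList-map : ∀ {f} → f Preserves _<_ ⟶ _<_ → ∀ w → desList (map f w) ≡ desList w
desList-map f-mono []          = refl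
desList-map f-mono (x ∷ [])    = refl
desList-map {f} f-mono (x ∷ y ∷ w) = cong₂ _+_
  (cong (λ b → if b then 1 else 0) (does-⇔ (mk⇔ (mono-reflects-< f-mono) f-mono) (f y <? f x) (y <? x)))
  (desList-map f-mono (y ∷ w))

desList-orderInvariant : ∀ d → OrderInvariant (λ w → 𝟙 (desList w ≡ᵇ d))
desList-orderInvariant d f f-mono w = cong (λ z → 𝟙 (z ≡ᵇ d)) (desList-map f-mono w)

desList-≤ : ∀ w → desList w ≤ length w
desList-≤ []          = z≤n
desList-≤ (x ∷ [])    = z≤n
desList-≤ (x ∷ y ∷ w) = step (does (y <? x)) (desList-≤ (y ∷ w))
  where
  step : ∀ b {D L} → D ≤ L → (if b then 1 else 0) + D ≤ suc L
  step true  D≤L = s≤s D≤L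
  step false D≤L = m≤n⇒m≤1+n D≤L

coeff-applyUpTo-< : ∀ (g : ℕ → ℕ) {L d} → d < L → coeff (applyUpTo g L) d ≡ g d
coeff-applyUpTo-< g {suc L} {zero}  _         = refl
coeff-applyUpTo-< g {suc L} {suc d} (s<s d<L) = coeff-applyUpTo-< (g ∘ suc) d<L

coeff-applyUpTo-≥ : ∀ (g : ℕ → ℕ) {L d} → L ≤ d → coeff (applyUpTo g L) d ≡ 0
coeff-applyUpTo-≥ g {zero}  _         = refl
coeff-applyUpTo-≥ g {suc L} (s≤s L≤d) = coeff-applyUpTo-≥ (g ∘ suc) L≤d

≡ᵇ-false : ∀ {m n} → m ≢ n → (m ≡ᵇ n) ≡ false
≡ᵇ-false {zero}  {zero}  m≢n = contradiction refl m≢n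
≡ᵇ-false {zero}  {suc n} _   = refl
≡ᵇ-false {suc m} {zero}  _   = refl
≡ᵇ-false {suc m} {suc n} m≢n = ≡ᵇ-false (m≢n ∘ cong suc)

coeff-A-∑ʷ : ∀ ℓ d → coeff (A ℓ) d ≡ ∑ʷ ℓ ℓ (λ w → distinctIn allAvail w * 𝟙 (desList w ≡ᵇ d))
coeff-A-∑ʷ ℓ d = trans (cong (λ p → coeff p d) (map-applyUpTo (λ x → x) count (suc ℓ))) (inRange (d <? suc ℓ))
  where
  count : ℕ → ℕ
  count d = countℕ des d (perms ℓ)
  inRange : Dec (d < suc ℓ) → coeff (applyUpTo count (suc ℓ)) d ≡ ∑ʷ ℓ ℓ (λ w → distinctIn allAvail w * 𝟙 (desList w ≡ᵇ d))
  inRange (yes d≤ℓ) = trans (coeff-applyUpTo-< count d≤ℓ) (countℕ-perms ℓ desList d)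
  inRange (no  d≰ℓ) = trans (coeff-applyUpTo-≥ count (≮⇒≥ d≰ℓ)) (sym (trans (∑ʷ-cong-on ℓ ℓ tooMany) (∑ʷ-zero ℓ ℓ)))
    where
    tooMany : ∀ w → Word ℓ ℓ w → distinctIn allAvail w * 𝟙 (desList w ≡ᵇ d) ≡ 0
    tooMany w (refl , _) rewrite ≡ᵇ-false (<⇒≢ (≤-trans (s≤s (desList-≤ w)) (≮⇒≥ d≰ℓ))) = *-zeroʳ (distinctIn allAvail w)

coeff-A : ∀ ℓ d → coeff (A ℓ) d ≡ ∑ᵖ ℓ (λ w → 𝟙 (desList w ≡ᵇ d))
coeff-A ℓ d = begin
  coeff (A ℓ) d                                               ≡⟨ coeff-A-∑ʷ ℓ d ⟩
  ∑ʷ ℓ ℓ (λ w → distinctIn allAvail w * 𝟙 (desList w ≡ᵇ d))  ≡⟨ ∑ʷ-distinctIn ℓ allAvail ℓ _ (desList-orderInvariant d) ⟩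
  (card ℓ allAvail C ℓ) * S                                   ≡⟨ cong (λ c → (c C ℓ) * S) (card-allAvail ℓ) ⟩
  (ℓ C ℓ) * S                                                 ≡⟨ cong (_* S) (nCn≡1 ℓ) ⟩
  1 * S                                                       ≡⟨ *-identityˡ S ⟩
  S                                                           ∎
  where
  S = ∑ᵖ ℓ (λ w → 𝟙 (desList w ≡ᵇ d))

length-insertAt : ∀ p a w → length (insertAt p a w) ≡ suc (length w)
length-insertAt zero    a w       = refl
length-insertAt (suc p) a []      = refl
length-insertAt (suc p) a (x ∷ w) = cong suc (length-insertAt p a w)

∑ᵖ-zero-on : ∀ m (G : List ℕ → ℕ) → (∀ w → length w ≡ m → G w ≡ 0) → ∑ᵖ m G ≡ 0
∑ᵖ-zero-on zero    G G≡0 = G≡0 [] refl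
∑ᵖ-zero-on (suc m) G G≡0 = trans (∑-cong (suc m) (λ p _ → ∑ᵖ-zero-on m _ (λ w → G≡0 (insertAt p 0 (map suc w)) ∘ length-insert0 p w))) (∑-zero (suc m))
  where
  length-insert0 : ∀ p w → length w ≡ m → length (insertAt p 0 (map suc w)) ≡ suc m
  length-insert0 p w len = trans (length-insertAt p 0 (map suc w)) (cong suc (trans (length-map suc w) len))

any-insertAt : ∀ p a w → Any (_≡ a) (insertAt p a w)
any-insertAt zero    a w       = here refl
any-insertAt (suc p) a []      = here refl
any-insertAt (suc p) a (x ∷ w) = there (any-insertAt p a w)

desList-pos : ∀ x L → x > 0 → Any (_≡ 0) L → desList (x ∷ L) ≢ 0
desList-pos (suc x) (zero  ∷ L) _ _           ()
desList-pos (suc x) (suc y ∷ L) _ (there 0∈L) = desList-pos (suc y) L z<s 0∈L ∘ m+n≡0⇒n≡0 _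

∑ᵖ-desList-0 : ∀ m → ∑ᵖ m (λ w → 𝟙 (desList w ≡ᵇ 0)) ≡ 1
∑ᵖ-desList-0 zero    = refl
∑ᵖ-desList-0 (suc m) = cong₂ _+_ zeroFirst (trans (∑-cong m zeroLater) (∑-zero m))
  where
  zeroFirst : ∑ᵖ m (λ w → 𝟙 (desList (0 ∷ map suc w) ≡ᵇ 0)) ≡ 1
  zeroFirst = trans (∑ᵖ-cong m (λ w → trans (shift w) (desList-orderInvariant 0 suc s<s w))) (∑ᵖ-desList-0 m)
    where
    shift : ∀ w → 𝟙 (desList (0 ∷ map suc w) ≡ᵇ 0) ≡ 𝟙 (desList (map suc w) ≡ᵇ 0)
    shift []      = refl
    shift (y ∷ w) = refl
  zeroLater : ∀ p → p < m → ∑ᵖ m (λ w → 𝟙 (desList (insertAt (suc p) 0 (map suc w)) ≡ᵇ 0)) ≡ 0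
  zeroLater p p<m = ∑ᵖ-zero-on m _ nonIdentity
    where
    nonIdentity : ∀ w → length w ≡ m → 𝟙 (desList (insertAt (suc p) 0 (map suc w)) ≡ᵇ 0) ≡ 0
    nonIdentity []      refl = contradiction p<m λ ()
    nonIdentity (y ∷ w) _    = cong 𝟙 (≡ᵇ-false (desList-pos (suc y) _ z<s (any-insertAt p 0 (map suc w))))

coeff-A-0 : ∀ ℓ → coeff (A ℓ) 0 ≡ 1
coeff-A-0 ℓ = trans (coeff-A ℓ 0) (∑ᵖ-desList-0 ℓ)

-- Polynomial arithmetic

_≈ₚ_ : Poly → Poly → Set
p ≈ₚ q = ∀ i → coeff p i ≡ coeff q i

coeff-⊕ : ∀ p q i → coeff (p ⊕ q) i ≡ coeff p i + coeff q i
coeff-⊕ []      q       i       = refl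
coeff-⊕ (a ∷ p) []      zero    = sym (+-identityʳ a)
coeff-⊕ (a ∷ p) []      (suc i) = sym (+-identityʳ _)
coeff-⊕ (a ∷ p) (b ∷ q) zero    = refl
coeff-⊕ (a ∷ p) (b ∷ q) (suc i) = coeff-⊕ p q i

coeff-scale : ∀ c p i → coeff (scale c p) i ≡ c * coeff p i
coeff-scale c []      i       = sym (*-zeroʳ c)
coeff-scale c (a ∷ p) zero    = refl
coeff-scale c (a ∷ p) (suc i) = coeff-scale c p i

coeff-⊗ : ∀ p q i → coeff (p ⊗ q) i ≡ ∑ (suc i) (λ d → coeff p d * coeff q (i ∸ d))
coeff-⊗ []      q i       = sym (∑-zero (suc i))
coeff-⊗ (a ∷ p) q zero    = begin
  coeff (scale a q ⊕ (0 ∷ (p ⊗ q))) 0   ≡⟨ coeff-⊕ (scale a q) _ 0 ⟩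
  coeff (scale a q) 0 + 0               ≡⟨ cong (_+ 0) (coeff-scale a q 0) ⟩
  a * coeff q 0 + 0                     ∎
coeff-⊗ (a ∷ p) q (suc i) = begin
  coeff (scale a q ⊕ (0 ∷ (p ⊗ q))) (suc i)      ≡⟨ coeff-⊕ (scale a q) _ (suc i) ⟩
  coeff (scale a q) (suc i) + coeff (p ⊗ q) i    ≡⟨ cong₂ _+_ (coeff-scale a q (suc i)) (coeff-⊗ p q i) ⟩
  a * coeff q (suc i) + ∑ (suc i) (λ d → coeff p d * coeff q (i ∸ d)) ∎

coeff-⊗-0 : ∀ p q → coeff (p ⊗ q) 0 ≡ coeff p 0 * coeff q 0
coeff-⊗-0 p q = trans (coeff-⊗ p q 0) (+-identityʳ _)

⊗-cong : ∀ {p p′ q q′} → p ≈ₚ p′ → q ≈ₚ q′ → (p ⊗ q) ≈ₚ (p′ ⊗ q′)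
⊗-cong {p} {p′} {q} {q′} p≈p′ q≈q′ i = begin
  coeff (p ⊗ q) i                                   ≡⟨ coeff-⊗ p q i ⟩
  ∑ (suc i) (λ d → coeff p d * coeff q (i ∸ d))     ≡⟨ ∑-cong (suc i) (λ d _ → cong₂ _*_ (p≈p′ d) (q≈q′ (i ∸ d))) ⟩
  ∑ (suc i) (λ d → coeff p′ d * coeff q′ (i ∸ d))   ≡⟨ coeff-⊗ p′ q′ i ⟨
  coeff (p′ ⊗ q′) i                                 ∎

⊗-distribʳ-⊕ : ∀ p q r → ((p ⊕ q) ⊗ r) ≈ₚ ((p ⊗ r) ⊕ (q ⊗ r))
⊗-distribʳ-⊕ p q r i = begin
  coeff ((p ⊕ q) ⊗ r) i
    ≡⟨ coeff-⊗ (p ⊕ q) r i ⟩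
  ∑ (suc i) (λ d → coeff (p ⊕ q) d * coeff r (i ∸ d))
    ≡⟨ ∑-cong (suc i) (λ d _ → trans (cong (_* coeff r (i ∸ d)) (coeff-⊕ p q d)) (*-distribʳ-+ (coeff r (i ∸ d)) (coeff p d) _)) ⟩
  ∑ (suc i) (λ d → coeff p d * coeff r (i ∸ d) + coeff q d * coeff r (i ∸ d))
    ≡⟨ ∑-distrib-+ (suc i) (λ d → coeff p d * coeff r (i ∸ d)) (λ d → coeff q d * coeff r (i ∸ d)) ⟩
  ∑ (suc i) (λ d → coeff p d * coeff r (i ∸ d)) + ∑ (suc i) (λ d → coeff q d * coeff r (i ∸ d))
    ≡⟨ cong₂ _+_ (coeff-⊗ p r i) (coeff-⊗ q r i) ⟨
  coeff (p ⊗ r) i + coeff (q ⊗ r) i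
    ≡⟨ coeff-⊕ (p ⊗ r) _ i ⟨
  coeff ((p ⊗ r) ⊕ (q ⊗ r)) i ∎

scale-⊗ : ∀ a q r → (scale a q ⊗ r) ≈ₚ scale a (q ⊗ r)
scale-⊗ a q r i = begin
  coeff (scale a q ⊗ r) i
    ≡⟨ coeff-⊗ (scale a q) r i ⟩
  ∑ (suc i) (λ d → coeff (scale a q) d * coeff r (i ∸ d))
    ≡⟨ ∑-cong (suc i) (λ d _ → trans (cong (_* coeff r (i ∸ d)) (coeff-scale a q d)) (*-assoc a _ _)) ⟩
  ∑ (suc i) (λ d → a * (coeff q d * coeff r (i ∸ d)))
    ≡⟨ ∑-*ˡ (suc i) a (λ d → coeff q d * coeff r (i ∸ d)) ⟩
  a * ∑ (suc i) (λ d → coeff q d * coeff r (i ∸ d))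
    ≡⟨ cong (a *_) (coeff-⊗ q r i) ⟨
  a * coeff (q ⊗ r) i
    ≡⟨ coeff-scale a (q ⊗ r) i ⟨
  coeff (scale a (q ⊗ r)) i ∎

0∷-⊗ : ∀ p r → ((0 ∷ p) ⊗ r) ≈ₚ (0 ∷ (p ⊗ r))
0∷-⊗ p r i = trans (coeff-⊕ (scale 0 r) _ i) (cong (_+ coeff (0 ∷ (p ⊗ r)) i) (coeff-scale 0 r i))

⊗-assoc : ∀ p q r → ((p ⊗ q) ⊗ r) ≈ₚ (p ⊗ (q ⊗ r))
⊗-assoc []      q r i = refl
⊗-assoc (a ∷ p) q r i = begin
  coeff ((scale a q ⊕ (0 ∷ (p ⊗ q))) ⊗ r) i
    ≡⟨ ⊗-distribʳ-⊕ (scale a q) (0 ∷ (p ⊗ q)) r i ⟩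
  coeff ((scale a q ⊗ r) ⊕ ((0 ∷ (p ⊗ q)) ⊗ r)) i
    ≡⟨ coeff-⊕ (scale a q ⊗ r) _ i ⟩
  coeff (scale a q ⊗ r) i + coeff ((0 ∷ (p ⊗ q)) ⊗ r) i
    ≡⟨ cong₂ _+_ (scale-⊗ a q r i) (trans (0∷-⊗ (p ⊗ q) r i) (shifted i)) ⟩
  coeff (scale a (q ⊗ r)) i + coeff (0 ∷ (p ⊗ (q ⊗ r))) i
    ≡⟨ coeff-⊕ (scale a (q ⊗ r)) _ i ⟨
  coeff (scale a (q ⊗ r) ⊕ (0 ∷ (p ⊗ (q ⊗ r)))) i ∎
  where
  shifted : (0 ∷ ((p ⊗ q) ⊗ r)) ≈ₚ (0 ∷ (p ⊗ (q ⊗ r)))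
  shifted zero    = refl
  shifted (suc i) = ⊗-assoc p q r i

⊗-identityˡ : ∀ p → ((1 ∷ []) ⊗ p) ≈ₚ p
⊗-identityˡ p i = begin
  coeff (scale 1 p ⊕ (0 ∷ [])) i            ≡⟨ coeff-⊕ (scale 1 p) _ i ⟩
  coeff (scale 1 p) i + coeff (0 ∷ []) i    ≡⟨ cong₂ _+_ (trans (coeff-scale 1 p i) (*-identityˡ _)) (zeroPoly i) ⟩
  coeff p i + 0                             ≡⟨ +-identityʳ _ ⟩
  coeff p i                                 ∎
  where
  zeroPoly : ∀ i → coeff (0 ∷ []) i ≡ 0
  zeroPoly zero    = refl
  zeroPoly (suc i) = refl

-- k-step runs

lastOr : {X : Set} → X → List X → X
lastOr d []          = d
lastOr d (x ∷ [])    = x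
lastOr d (x ∷ y ∷ P) = lastOr d (y ∷ P)

init : {X : Set} → List X → List X
init []          = []
init (x ∷ [])    = []
init (x ∷ y ∷ P) = x ∷ init (y ∷ P)

init-++-lastOr : ∀ {X : Set} (d : X) P {j} → length P ≡ suc j → P ≡ init P ++ [ lastOr d P ]
init-++-lastOr d (x ∷ [])    len = refl
init-++-lastOr d (x ∷ y ∷ P) {suc j} len = cong (x ∷_) (init-++-lastOr d (y ∷ P) (suc-injective len))

length-init : ∀ {X : Set} (P : List X) {j} → length P ≡ suc j → length (init P) ≡ j
length-init (x ∷ [])    {zero}  len = refl
length-init (x ∷ y ∷ P) {suc j} len = cong suc (length-init (y ∷ P) (suc-injective len))

init-∷ʳ : ∀ {X : Set} (R : List X) q → init (R ++ [ q ]) ≡ R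
init-∷ʳ []          q = refl
init-∷ʳ (x ∷ [])    q = refl
init-∷ʳ (x ∷ y ∷ R) q = cong (x ∷_) (init-∷ʳ (y ∷ R) q)

lastOr-∷ʳ : ∀ {X : Set} (d : X) R q → lastOr d (R ++ [ q ]) ≡ q
lastOr-∷ʳ d []          q = refl
lastOr-∷ʳ d (x ∷ [])    q = refl
lastOr-∷ʳ d (x ∷ y ∷ R) q = lastOr-∷ʳ d (y ∷ R) q

-- runs k w lists the k k-step runs of w. Prepending x to w makes x the head of
-- the old last run, which becomes the new first run.
push : ℕ → List (List ℕ) → List (List ℕ)
push x P = (x ∷ lastOr [] P) ∷ init P

runs : ℕ → List ℕ → List (List ℕ)
runs k []      = replicate k []
runs k (x ∷ w) = push x (runs k w)

-- the lengths of the runs of any word of length n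
runLengths : ℕ → ℕ → List ℕ
runLengths k zero    = replicate k 0
runLengths k (suc n) = suc (lastOr 0 (runLengths k n)) ∷ init (runLengths k n)

length-runs : ∀ k′ w → length (runs (suc k′) w) ≡ suc k′
length-runs k′ []      = cong suc (length-replicate k′)
length-runs k′ (x ∷ w) = cong suc (length-init (runs (suc k′) w) (length-runs k′ w))

length-runLengths : ∀ k′ n → length (runLengths (suc k′) n) ≡ suc k′
length-runLengths k′ zero    = cong suc (length-replicate k′)
length-runLengths k′ (suc n) = cong suc (length-init (runLengths (suc k′) n) (length-runLengths k′ n))

∑ʷˢ : ℕ → List ℕ → (List (List ℕ) → ℕ) → ℕ
∑ʷˢ N []      F = F []
∑ʷˢ N (m ∷ L) F = ∑ʷ N m (λ u → ∑ʷˢ N L (F ∘ (u ∷_)))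

∑ʷˢ-cong : ∀ N L {F G : List (List ℕ) → ℕ} → (∀ P → F P ≡ G P) → ∑ʷˢ N L F ≡ ∑ʷˢ N L G
∑ʷˢ-cong N []      eq = eq []
∑ʷˢ-cong N (m ∷ L) eq = ∑ʷ-cong N m (λ u → ∑ʷˢ-cong N L (eq ∘ (u ∷_)))

∑ʷˢ-replicate-0 : ∀ N k F → ∑ʷˢ N (replicate k 0) F ≡ F (replicate k [])
∑ʷˢ-replicate-0 N zero    F = refl
∑ʷˢ-replicate-0 N (suc k) F = ∑ʷˢ-replicate-0 N k (F ∘ ([] ∷_))

∑ʷˢ-∷ʳ : ∀ N L l (F : List (List ℕ) → ℕ) → ∑ʷˢ N (L ++ [ l ]) F ≡ ∑ʷ N l (λ q → ∑ʷˢ N L (λ R → F (R ++ [ q ])))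
∑ʷˢ-∷ʳ N []      l F = refl
∑ʷˢ-∷ʳ N (m ∷ L) l F = begin
  ∑ʷ N m (λ u → ∑ʷˢ N (L ++ [ l ]) (F ∘ (u ∷_)))
    ≡⟨ ∑ʷ-cong N m (λ u → ∑ʷˢ-∷ʳ N L l (F ∘ (u ∷_))) ⟩
  ∑ʷ N m (λ u → ∑ʷ N l (λ q → ∑ʷˢ N L (λ R → F (u ∷ R ++ [ q ]))))
    ≡⟨ ∑ʷ-comm N m l (λ u q → ∑ʷˢ N L (λ R → F (u ∷ R ++ [ q ]))) ⟩
  ∑ʷ N l (λ q → ∑ʷ N m (λ u → ∑ʷˢ N L (λ R → F (u ∷ R ++ [ q ])))) ∎

-- Splitting words into runs is a bijection onto tuples of words of the run lengths.
∑ʷ-runs : ∀ N k′ n (F : List (List ℕ) → ℕ) → ∑ʷ N n (F ∘ runs (suc k′)) ≡ ∑ʷˢ N (runLengths (suc k′) n) F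
∑ʷ-runs N k′ zero    F = sym (∑ʷˢ-replicate-0 N (suc k′) F)
∑ʷ-runs N k′ (suc n) F = ∑-cong N (λ x _ → trans (∑ʷ-runs N k′ n (F ∘ push x)) (pushed x))
  where
  L = runLengths (suc k′) n
  pushed : ∀ x → ∑ʷˢ N L (F ∘ push x) ≡ ∑ʷ N (lastOr 0 L) (λ q → ∑ʷˢ N (init L) (λ R → F ((x ∷ q) ∷ R)))
  pushed x = begin
    ∑ʷˢ N L (F ∘ push x)
      ≡⟨ cong (λ L′ → ∑ʷˢ N L′ (F ∘ push x)) (init-++-lastOr 0 L (length-runLengths k′ n)) ⟩
    ∑ʷˢ N (init L ++ [ lastOr 0 L ]) (F ∘ push x)
      ≡⟨ ∑ʷˢ-∷ʳ N (init L) (lastOr 0 L) _ ⟩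
    ∑ʷ N (lastOr 0 L) (λ q → ∑ʷˢ N (init L) (λ R → F (push x (R ++ [ q ]))))
      ≡⟨ ∑ʷ-cong N (lastOr 0 L) (λ q → ∑ʷˢ-cong N (init L) (λ R →
           cong₂ (λ u P → F ((x ∷ u) ∷ P)) (lastOr-∷ʳ [] R q) (init-∷ʳ R q))) ⟩
    ∑ʷ N (lastOr 0 L) (λ q → ∑ʷˢ N (init L) (λ R → F ((x ∷ q) ∷ R))) ∎

pileAt : ℕ → List (List ℕ) → List ℕ
pileAt _       []      = []
pileAt zero    (u ∷ P) = u
pileAt (suc j) (u ∷ P) = pileAt j P

pileAt-init : ∀ j P → suc j < length P → pileAt j (init P) ≡ pileAt j P
pileAt-init zero    (u ∷ [])    (s<s ())
pileAt-init zero    (u ∷ v ∷ P) _           = refl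
pileAt-init (suc j) (u ∷ v ∷ P) (s<s j<len) = pileAt-init j (v ∷ P) j<len

pileAt-last : ∀ j P → length P ≡ suc j → lastOr [] P ≡ pileAt j P
pileAt-last zero    (u ∷ [])    _   = refl
pileAt-last (suc j) (u ∷ v ∷ P) len = pileAt-last j (v ∷ P) (suc-injective len)

pileAt-replicate : ∀ j k → pileAt j (replicate k []) ≡ []
pileAt-replicate j       zero    = refl
pileAt-replicate zero    (suc k) = refl
pileAt-replicate (suc j) (suc k) = pileAt-replicate j k

head-pileAt-runs : ∀ k′ j w → j ≤ k′ → head (pileAt j (runs (suc k′) w)) ≡ head (drop j w)
head-pileAt-runs k′ j       []      _         = cong head (trans (pileAt-replicate j (suc k′)) (sym (drop-[] j)))
head-pileAt-runs k′ zero    (x ∷ w) _         = refl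
head-pileAt-runs k′ (suc j) (x ∷ w) (s≤s j≤k′) = begin
  head (pileAt j (init (runs (suc k′) w)))
    ≡⟨ cong head (pileAt-init j (runs (suc k′) w) (subst (suc j <_) (sym (length-runs k′ w)) (s<s (s≤s j≤k′)))) ⟩
  head (pileAt j (runs (suc k′) w))
    ≡⟨ head-pileAt-runs k′ j w (m≤n⇒m≤1+n j≤k′) ⟩
  head (drop j w) ∎

sum-desList-init : ∀ P {j} → length P ≡ suc j →
  sum (map desList P) ≡ sum (map desList (init P)) + desList (lastOr [] P)
sum-desList-init P len = begin
  sum (map desList P)                                          ≡⟨ cong (sum ∘ map desList) (init-++-lastOr [] P len) ⟩
  sum (map desList (init P ++ [ lastOr [] P ]))                ≡⟨ cong sum (map-++ desList (init P) _) ⟩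
  sum (map desList (init P) ++ [ desList (lastOr [] P) ])      ≡⟨ sum-++ (map desList (init P)) _ ⟩
  sum (map desList (init P)) + (desList (lastOr [] P) + 0)     ≡⟨ cong (sum (map desList (init P)) +_) (+-identityʳ _) ⟩
  sum (map desList (init P)) + desList (lastOr [] P)           ∎

desList-∷ : ∀ x q → desList (x ∷ q) ≡ descentᵐ (just x) (head q) + desList q
desList-∷ x []      = refl
desList-∷ x (y ∷ q) = refl

sum-desList-replicate : ∀ k → sum (map desList (replicate k [])) ≡ 0
sum-desList-replicate zero    = refl
sum-desList-replicate (suc k) = sum-desList-replicate k

invʷ-runs : ∀ k′ w → invʷ k′ w ≡ sum (map desList (runs (suc k′) w))
invʷ-runs k′ []      = sym (sum-desList-replicate (suc k′))
invʷ-runs k′ (x ∷ w) = begin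
  descentᵐ (just x) (head (drop k′ w)) + invʷ k′ w
    ≡⟨ cong₂ _+_ (cong (descentᵐ (just x)) (sym lastHead)) (trans (invʷ-runs k′ w) (sum-desList-init P (length-runs k′ w))) ⟩
  descentᵐ (just x) (head (lastOr [] P)) + (sum (map desList (init P)) + desList (lastOr [] P))
    ≡⟨ +-right-comm (descentᵐ (just x) (head (lastOr [] P))) _ _ ⟩
  descentᵐ (just x) (head (lastOr [] P)) + desList (lastOr [] P) + sum (map desList (init P))
    ≡⟨ cong (_+ sum (map desList (init P))) (sym (desList-∷ x (lastOr [] P))) ⟩
  sum (map desList (push x P)) ∎
  where
  P = runs (suc k′) w
  lastHead : head (lastOr [] P) ≡ head (drop k′ w)
  lastHead = trans (cong head (pileAt-last k′ P (length-runs k′ w))) (head-pileAt-runs k′ k′ w ≤-refl)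

concat-replicate-[] : ∀ {X : Set} k → concat (replicate {A = List X} k []) ≡ []
concat-replicate-[] zero    = refl
concat-replicate-[] (suc k) = concat-replicate-[] k

concat-init : ∀ (P : List (List ℕ)) {j} → length P ≡ suc j → concat P ≡ concat (init P) ++ lastOr [] P
concat-init (u ∷ [])    _   = ++-identityʳ u
concat-init (u ∷ v ∷ P) {suc j} len = trans (cong (u ++_) (concat-init (v ∷ P) (suc-injective len))) (sym (++-assoc u _ _))

concat-runs-↭ : ∀ k′ w → concat (runs (suc k′) w) ↭ w
concat-runs-↭ k′ []      = ↭.↭-reflexive (concat-replicate-[] (suc k′))
concat-runs-↭ k′ (x ∷ w) = ↭.prep x (↭.↭-trans (++-comm (lastOr [] P) (concat (init P)))
  (↭.↭-trans (↭.↭-reflexive (sym (concat-init P (length-runs k′ w)))) (concat-runs-↭ k′ w)))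
  where
  P = runs (suc k′) w

-- Factorisation over the runs

applyUpTo-cong : ∀ K {f g : ℕ → ℕ} → (∀ j → j < K → f j ≡ g j) → applyUpTo f K ≡ applyUpTo g K
applyUpTo-cong zero    eq = refl
applyUpTo-cong (suc K) eq = cong₂ _∷_ (eq 0 z<s) (applyUpTo-cong K (λ j j<K → eq (suc j) (s<s j<K)))

multinomial : ℕ → List ℕ → ℕ
multinomial c []      = 1
multinomial c (m ∷ L) = (c C m) * multinomial (c ∸ m) L

∏A : List ℕ → Poly
∏A []      = 1 ∷ []
∏A (m ∷ L) = A m ⊗ ∏A L

multinomial-∷ʳ : ∀ c L m → multinomial c (L ++ [ m ]) ≡ multinomial c L * ((c ∸ sum L) C m)
multinomial-∷ʳ c []      m = trans (*-identityʳ _) (sym (+-identityʳ _))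
multinomial-∷ʳ c (x ∷ L) m = begin
  (c C x) * multinomial (c ∸ x) (L ++ [ m ])                 ≡⟨ cong ((c C x) *_) (multinomial-∷ʳ (c ∸ x) L m) ⟩
  (c C x) * (multinomial (c ∸ x) L * ((c ∸ x ∸ sum L) C m))  ≡⟨ *-assoc (c C x) _ _ ⟨
  (c C x) * multinomial (c ∸ x) L * ((c ∸ x ∸ sum L) C m)    ≡⟨ cong (λ z → (c C x) * multinomial (c ∸ x) L * (z C m)) (∸-+-assoc c x (sum L)) ⟩
  (c C x) * multinomial (c ∸ x) L * ((c ∸ (x + sum L)) C m)  ∎

multinomial-∷ʳ-rest : ∀ c L m → sum L + m ≡ c → multinomial c (L ++ [ m ]) ≡ multinomial c L
multinomial-∷ʳ-rest c L m total = begin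
  multinomial c (L ++ [ m ])            ≡⟨ multinomial-∷ʳ c L m ⟩
  multinomial c L * ((c ∸ sum L) C m)   ≡⟨ cong (λ r → multinomial c L * (r C m)) c∸sum≡m ⟩
  multinomial c L * (m C m)             ≡⟨ cong (multinomial c L *_) (nCn≡1 m) ⟩
  multinomial c L * 1                   ≡⟨ *-identityʳ _ ⟩
  multinomial c L                       ∎
  where
  c∸sum≡m : c ∸ sum L ≡ m
  c∸sum≡m = trans (cong (_∸ sum L) (sym total)) (m+n∸m≡n (sum L) m)

product-binomials : ∀ K c (g : ℕ → ℕ) →
  product (applyUpTo (λ j → (c ∸ sum (applyUpTo g j)) C g j) K) ≡ multinomial c (applyUpTo g K)
product-binomials zero    c g = refl
product-binomials (suc K) c g = cong ((c C g 0) *_) (trans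
  (cong product (applyUpTo-cong K (λ j _ → cong (λ z → z C g (suc j)) (sym (∸-+-assoc c (g 0) _)))))
  (product-binomials K (c ∸ g 0) (g ∘ suc)))

∏A-constant : ∀ b s (h : ℕ → ℕ) → (∀ j → j < s → h j ≡ b) → ∏A (applyUpTo h s) ≈ₚ (A b ^ₚ s)
∏A-constant b zero    h h≡b i = refl
∏A-constant b (suc s) h h≡b = ⊗-cong {A (h 0)} {A b} {∏A (applyUpTo (h ∘ suc) s)} {A b ^ₚ s}
  (λ i → cong (λ z → coeff (A z) i) (h≡b 0 z<s))
  (∏A-constant b s (h ∘ suc) (λ j j<s → h≡b (suc j) (s<s j<s)))

∏A-two-constants : ∀ a b t s (h : ℕ → ℕ) → (∀ j → j < t → h j ≡ a) → (∀ j → j < s → h (t + j) ≡ b) →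
  ∏A (applyUpTo h (t + s)) ≈ₚ ((A a ^ₚ t) ⊗ (A b ^ₚ s))
∏A-two-constants a b zero    s h h≡a h≡b i = trans (∏A-constant b s h h≡b i) (sym (⊗-identityˡ (A b ^ₚ s) i))
∏A-two-constants a b (suc t) s h h≡a h≡b i = begin
  coeff (A (h 0) ⊗ ∏A (applyUpTo (h ∘ suc) (t + s))) i
    ≡⟨ ⊗-cong {A (h 0)} {A a} {∏A (applyUpTo (h ∘ suc) (t + s))} {(A a ^ₚ t) ⊗ (A b ^ₚ s)}
              (λ i → cong (λ z → coeff (A z) i) (h≡a 0 z<s))
              (∏A-two-constants a b t s (h ∘ suc) (λ j j<t → h≡a (suc j) (s<s j<t)) h≡b) i ⟩
  coeff (A a ⊗ ((A a ^ₚ t) ⊗ (A b ^ₚ s))) i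
    ≡⟨ ⊗-assoc (A a) (A a ^ₚ t) (A b ^ₚ s) i ⟨
  coeff ((A a ^ₚ suc t) ⊗ (A b ^ₚ s)) i ∎

coeff-∏A-0 : ∀ L → coeff (∏A L) 0 ≡ 1
coeff-∏A-0 []      = refl
coeff-∏A-0 (m ∷ L) = trans (coeff-⊗-0 (A m) (∏A L)) (cong₂ _*_ (coeff-A-0 m) (coeff-∏A-0 L))

∑ʷˢ-*ˡ : ∀ N L c (F : List (List ℕ) → ℕ) → ∑ʷˢ N L (λ P → c * F P) ≡ c * ∑ʷˢ N L F
∑ʷˢ-*ˡ N []      c F = refl
∑ʷˢ-*ˡ N (m ∷ L) c F = trans (∑ʷ-cong N m (λ u → ∑ʷˢ-*ˡ N L c (F ∘ (u ∷_)))) (∑ʷ-*ˡ N m c _)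

∑-∑ʷˢ-comm : ∀ K N L (F : ℕ → List (List ℕ) → ℕ) →
  ∑ K (λ d → ∑ʷˢ N L (F d)) ≡ ∑ʷˢ N L (λ P → ∑ K (λ d → F d P))
∑-∑ʷˢ-comm K N []      F = refl
∑-∑ʷˢ-comm K N (m ∷ L) F = trans (∑-∑ʷ-comm K N m (λ d u → ∑ʷˢ N L (F d ∘ (u ∷_))))
                                  (∑ʷ-cong N m (λ u → ∑-∑ʷˢ-comm K N L (λ d → F d ∘ (u ∷_))))

𝟙-+-≡ᵇ : ∀ a b i → 𝟙 (a + b ≡ᵇ i) ≡ ∑ (suc i) (λ d → 𝟙 (a ≡ᵇ d) * 𝟙 (b ≡ᵇ i ∸ d))
𝟙-+-≡ᵇ zero    b i       = sym (trans (cong₂ _+_ (+-identityʳ _) (∑-zero i)) (+-identityʳ _))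
𝟙-+-≡ᵇ (suc a) b zero    = refl
𝟙-+-≡ᵇ (suc a) b (suc i) = 𝟙-+-≡ᵇ a b i

distinctIn-01 : ∀ av u → distinctIn av u ≡ 0 ⊎ distinctIn av u ≡ 1
distinctIn-01 av u rewrite distinctIn-char av u with all av u ∧ distinct u
... | true  = inj₂ refl
... | false = inj₁ refl

coeff-1 : ∀ i → coeff (1 ∷ []) i ≡ 𝟙 (0 ≡ᵇ i)
coeff-1 zero    = refl
coeff-1 (suc i) = refl

runsWith : Avail → ℕ → List (List ℕ) → ℕ
runsWith av i P = distinctIn av (concat P) * 𝟙 (sum (map desList P) ≡ᵇ i)

Factorises : ℕ → List ℕ → Set
Factorises N L = ∀ av i → ∑ʷˢ N L (runsWith av i) ≡ multinomial (card N av) L * coeff (∏A L) i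

-- After a distinct first run of length m, card N av ∸ m letters remain available.
∑ʷˢ-runsWith-∷ : ∀ N m L → Factorises N L → ∀ av i u → Word N m u →
  ∑ʷˢ N L (runsWith av i ∘ (u ∷_))
  ≡ distinctIn av u * ∑ (suc i) (λ d → 𝟙 (desList u ≡ᵇ d) * (multinomial (card N av ∸ m) L * coeff (∏A L) (i ∸ d)))
∑ʷˢ-runsWith-∷ N m L factorises av i u (len , u<N) = begin
  ∑ʷˢ N L (λ R → distinctIn av (u ++ concat R) * 𝟙 (desList u + sum (map desList R) ≡ᵇ i))
    ≡⟨ ∑ʷˢ-cong N L (λ R → trans (cong₂ _*_ (distinctIn-++ av u (concat R)) (𝟙-+-≡ᵇ (desList u) _ i))
                                  (trans (*-assoc (distinctIn av u) _ _) (cong (distinctIn av u *_) (regroup R)))) ⟩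
  ∑ʷˢ N L (λ R → distinctIn av u * ∑ (suc i) (λ d → 𝟙 (desList u ≡ᵇ d) * runsWith av′ (i ∸ d) R))
    ≡⟨ ∑ʷˢ-*ˡ N L (distinctIn av u) _ ⟩
  distinctIn av u * ∑ʷˢ N L (λ R → ∑ (suc i) (λ d → 𝟙 (desList u ≡ᵇ d) * runsWith av′ (i ∸ d) R))
    ≡⟨ cong (distinctIn av u *_) (sym (∑-∑ʷˢ-comm (suc i) N L (λ d R → 𝟙 (desList u ≡ᵇ d) * runsWith av′ (i ∸ d) R))) ⟩
  distinctIn av u * ∑ (suc i) (λ d → ∑ʷˢ N L (λ R → 𝟙 (desList u ≡ᵇ d) * runsWith av′ (i ∸ d) R))
    ≡⟨ cong (distinctIn av u *_) (∑-cong (suc i) (λ d _ → trans (∑ʷˢ-*ˡ N L (𝟙 (desList u ≡ᵇ d)) (runsWith av′ (i ∸ d)))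
         (cong (𝟙 (desList u ≡ᵇ d) *_) (factorises av′ (i ∸ d))))) ⟩
  distinctIn av u * ∑ (suc i) (λ d → 𝟙 (desList u ≡ᵇ d) * (multinomial (card N av′) L * coeff (∏A L) (i ∸ d)))
    ≡⟨ remaining (distinctIn-01 av u) ⟩
  distinctIn av u * ∑ (suc i) (λ d → 𝟙 (desList u ≡ᵇ d) * (multinomial (card N av ∸ m) L * coeff (∏A L) (i ∸ d))) ∎
  where
  av′ = removeAll av u

  regroup : ∀ R → distinctIn av′ (concat R) * ∑ (suc i) (λ d → 𝟙 (desList u ≡ᵇ d) * 𝟙 (sum (map desList R) ≡ᵇ i ∸ d))
                ≡ ∑ (suc i) (λ d → 𝟙 (desList u ≡ᵇ d) * runsWith av′ (i ∸ d) R)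
  regroup R = trans
    (sym (∑-*ˡ (suc i) (distinctIn av′ (concat R)) (λ d → 𝟙 (desList u ≡ᵇ d) * 𝟙 (sum (map desList R) ≡ᵇ i ∸ d))))
    (∑-cong (suc i) (λ d _ → *-left-comm (distinctIn av′ (concat R)) (𝟙 (desList u ≡ᵇ d)) (𝟙 (sum (map desList R) ≡ᵇ i ∸ d))))

  remaining : distinctIn av u ≡ 0 ⊎ distinctIn av u ≡ 1 →
    distinctIn av u * ∑ (suc i) (λ d → 𝟙 (desList u ≡ᵇ d) * (multinomial (card N av′) L * coeff (∏A L) (i ∸ d)))
    ≡ distinctIn av u * ∑ (suc i) (λ d → 𝟙 (desList u ≡ᵇ d) * (multinomial (card N av ∸ m) L * coeff (∏A L) (i ∸ d)))
  remaining (inj₁ D≡0) rewrite D≡0 = refl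
  remaining (inj₂ D≡1) = cong (distinctIn av u *_) (∑-cong (suc i) (λ d _ →
    cong (λ r → 𝟙 (desList u ≡ᵇ d) * (multinomial r L * coeff (∏A L) (i ∸ d))) card-av′))
    where
    card-av′ : card N av′ ≡ card N av ∸ m
    card-av′ = trans (sym (m+n∸n≡m _ m))
      (cong (_∸ m) (trans (cong (card N av′ +_) (sym len)) (card-removeAll N av u D≡1 u<N)))

factorises : ∀ N L → Factorises N L
factorises N []      av i = cong (_+ 0) (sym (coeff-1 i))
factorises N (m ∷ L) av i = begin
  ∑ʷ N m (λ u → ∑ʷˢ N L (runsWith av i ∘ (u ∷_)))
    ≡⟨ ∑ʷ-cong-on N m (∑ʷˢ-runsWith-∷ N m L (factorises N L) av i) ⟩
  ∑ʷ N m (λ u → distinctIn av u * ∑ (suc i) (λ d → 𝟙 (desList u ≡ᵇ d) * K d))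
    ≡⟨ ∑ʷ-cong N m (λ u → trans (sym (∑-*ˡ (suc i) (distinctIn av u) (λ d → 𝟙 (desList u ≡ᵇ d) * K d)))
                                (∑-cong (suc i) (λ d _ → sym (*-assoc (distinctIn av u) (𝟙 (desList u ≡ᵇ d)) (K d))))) ⟩
  ∑ʷ N m (λ u → ∑ (suc i) (λ d → distinctIn av u * 𝟙 (desList u ≡ᵇ d) * K d))
    ≡⟨ sym (∑-∑ʷ-comm (suc i) N m (λ d u → distinctIn av u * 𝟙 (desList u ≡ᵇ d) * K d)) ⟩
  ∑ (suc i) (λ d → ∑ʷ N m (λ u → distinctIn av u * 𝟙 (desList u ≡ᵇ d) * K d))
    ≡⟨ ∑-cong (suc i) (λ d _ → trans (∑ʷ-*ʳ N m (K d) _) (cong (_* K d) (firstRunDescents d))) ⟩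
  ∑ (suc i) (λ d → (c C m) * coeff (A m) d * (multinomial (c ∸ m) L * coeff (∏A L) (i ∸ d)))
    ≡⟨ ∑-cong (suc i) (λ d _ → *-interchange (c C m) (coeff (A m) d) (multinomial (c ∸ m) L) (coeff (∏A L) (i ∸ d))) ⟩
  ∑ (suc i) (λ d → multinomial c (m ∷ L) * (coeff (A m) d * coeff (∏A L) (i ∸ d)))
    ≡⟨ ∑-*ˡ (suc i) (multinomial c (m ∷ L)) (λ d → coeff (A m) d * coeff (∏A L) (i ∸ d)) ⟩
  multinomial c (m ∷ L) * ∑ (suc i) (λ d → coeff (A m) d * coeff (∏A L) (i ∸ d))
    ≡⟨ cong (multinomial c (m ∷ L) *_) (coeff-⊗ (A m) (∏A L) i) ⟨
  multinomial c (m ∷ L) * coeff (∏A (m ∷ L)) i ∎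
  where
  c = card N av
  K : ℕ → ℕ
  K d = multinomial (c ∸ m) L * coeff (∏A L) (i ∸ d)

  firstRunDescents : ∀ d → ∑ʷ N m (λ u → distinctIn av u * 𝟙 (desList u ≡ᵇ d)) ≡ (c C m) * coeff (A m) d
  firstRunDescents d = trans (∑ʷ-distinctIn N av m _ (desList-orderInvariant d)) (cong ((c C m) *_) (sym (coeff-A m d)))

-- Run lengths

replicate-applyUpTo : ∀ {X : Set} K (x : X) → replicate K x ≡ applyUpTo (λ _ → x) K
replicate-applyUpTo zero    x = refl
replicate-applyUpTo (suc K) x = cong (x ∷_) (replicate-applyUpTo K x)

[r+q*n]/n≡q : ∀ n .{{_ : NonZero n}} q r → r < n → (r + q * n) / n ≡ q
[r+q*n]/n≡q n q r r<n = begin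
  (r + q * n) / n      ≡⟨ +-distrib-/ r (q * n) fits ⟩
  r / n + q * n / n    ≡⟨ cong₂ _+_ (m<n⇒m/n≡0 r<n) (m*n/n≡m q n) ⟩
  q                    ∎
  where
  fits : r % n + q * n % n < n
  fits = subst (_< n) (sym (trans (cong₂ _+_ (m<n⇒m%n≡m r<n) (m*n%n≡0 q n)) (+-identityʳ r))) r<n

[m+n]/n≡1+m/n : ∀ m n .{{_ : NonZero n}} → (m + n) / n ≡ suc (m / n)
[m+n]/n≡1+m/n m n = trans (m/n≡1+[m∸n]/n (m≤n+m n m)) (cong (λ z → suc (z / n)) (m+n∸n≡m m n))

runLength : ℕ → ℕ → ℕ → ℕ
runLength k′ n j = (n + suc k′ ∸ suc j) / suc k′

runLengths-closed : ∀ k′ n → runLengths (suc k′) n ≡ applyUpTo (runLength k′ n) (suc k′)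
runLengths-closed k′ zero = trans (replicate-applyUpTo (suc k′) 0)
  (applyUpTo-cong (suc k′) (λ j j<k → sym (m<n⇒m/n≡0 (s≤s (m∸n≤m k′ j)))))
runLengths-closed k′ (suc n) rewrite runLengths-closed k′ n | sym (applyUpTo-∷ʳ (runLength k′ n) k′) = cong₂ _∷_
  (trans (cong suc (lastOr-∷ʳ 0 (applyUpTo (runLength k′ n) k′) (runLength k′ n k′)))
         (trans (cong (λ z → suc (z / suc k′)) (m+n∸n≡m n (suc k′))) (sym ([m+n]/n≡1+m/n n (suc k′)))))
  (init-∷ʳ (applyUpTo (runLength k′ n) k′) (runLength k′ n k′))

sum-replicate-0 : ∀ K → sum (replicate K 0) ≡ 0
sum-replicate-0 zero    = refl
sum-replicate-0 (suc K) = sum-replicate-0 K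

sum-runLengths : ∀ k′ n → sum (runLengths (suc k′) n) ≡ n
sum-runLengths k′ zero    = sum-replicate-0 (suc k′)
sum-runLengths k′ (suc n) = cong suc (begin
  lastOr 0 L + sum (init L)               ≡⟨ +-comm (lastOr 0 L) _ ⟩
  sum (init L) + lastOr 0 L               ≡⟨ cong (sum (init L) +_) (+-identityʳ _) ⟨
  sum (init L) + (lastOr 0 L + 0)         ≡⟨ sum-++ (init L) [ lastOr 0 L ] ⟨
  sum (init L ++ [ lastOr 0 L ])          ≡⟨ cong sum (init-++-lastOr 0 L (length-runLengths k′ n)) ⟨
  sum L                                   ≡⟨ sum-runLengths k′ n ⟩
  n                                       ∎)
  where
  L = runLengths (suc k′) n

runLength-long : ∀ k′ n j → j < n % suc k′ → runLength k′ n j ≡ n / suc k′ + 1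
runLength-long k′ n j j<t = begin
  (n + k ∸ suc j) / k      ≡⟨ cong (_/ k) n+k∸1+j ⟩
  (r + suc q * k) / k      ≡⟨ [r+q*n]/n≡q k (suc q) r (≤-<-trans (m∸n≤m t (suc j)) (m%n<n n k)) ⟩
  suc q                    ≡⟨ +-comm 1 q ⟩
  q + 1                    ∎
  where
  k = suc k′
  q = n / k
  t = n % k
  r = t ∸ suc j
  n+k∸1+j : n + k ∸ suc j ≡ r + suc q * k
  n+k∸1+j = begin
    n + k ∸ suc j
      ≡⟨ cong (λ z → z + k ∸ suc j) (trans (m≡m%n+[m/n]*n n k) (cong (_+ q * k) (sym (m+[n∸m]≡n j<t)))) ⟩
    suc j + r + q * k + k ∸ suc j
      ≡⟨ cong (_∸ suc j) (regroup (suc j) r (q * k) k) ⟩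
    suc j + (r + (k + q * k)) ∸ suc j
      ≡⟨ m+n∸m≡n (suc j) _ ⟩
    r + suc q * k ∎
    where
    regroup : ∀ a b c d → a + b + c + d ≡ a + (b + (d + c))
    regroup = solve-∀

runLength-short : ∀ k′ n j → j < suc k′ ∸ n % suc k′ → runLength k′ n (n % suc k′ + j) ≡ n / suc k′
runLength-short k′ n j j<s = begin
  (n + k ∸ suc (t + j)) / k   ≡⟨ cong (_/ k) n+k∸1+t+j ⟩
  (t + r + q * k) / k         ≡⟨ [r+q*n]/n≡q k q (t + r) t+r<k ⟩
  q                           ∎
  where
  k = suc k′
  q = n / k
  t = n % k
  r = k ∸ suc (t + j)
  1+t+j+r≡k : suc (t + j) + r ≡ k
  1+t+j+r≡k = m+[n∸m]≡n (subst (t + j <_) (m+[n∸m]≡n (<⇒≤ (m%n<n n k))) (+-monoʳ-< t j<s))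
  t+r<k : t + r < k
  t+r<k = subst (t + r <_) 1+t+j+r≡k (+-monoˡ-< r (s≤s (m≤m+n t j)))
  n+k∸1+t+j : n + k ∸ suc (t + j) ≡ t + r + q * k
  n+k∸1+t+j = begin
    n + k ∸ suc (t + j)
      ≡⟨ cong (λ z → z + k ∸ suc (t + j)) (m≡m%n+[m/n]*n n k) ⟩
    t + q * k + k ∸ suc (t + j)
      ≡⟨ cong (λ z → t + q * z + z ∸ suc (t + j)) (sym 1+t+j+r≡k) ⟩
    t + q * (suc (t + j) + r) + (suc (t + j) + r) ∸ suc (t + j)
      ≡⟨ cong (_∸ suc (t + j)) (regroup t q j r) ⟩
    suc (t + j) + (t + r + q * (suc (t + j) + r)) ∸ suc (t + j)
      ≡⟨ m+n∸m≡n (suc (t + j)) _ ⟩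
    t + r + q * (suc (t + j) + r)
      ≡⟨ cong (λ z → t + r + q * z) 1+t+j+r≡k ⟩
    t + r + q * k ∎
    where
    regroup : ∀ t q j r → t + q * (suc (t + j) + r) + (suc (t + j) + r) ≡ suc (t + j) + (t + r + q * (suc (t + j) + r))
    regroup = solve-∀

∏A-runLengths : ∀ n k′ → ∏A (runLengths (suc k′) n)
  ≈ₚ ((A (n / suc k′ + 1) ^ₚ (n % suc k′)) ⊗ (A (n / suc k′) ^ₚ (suc k′ ∸ n % suc k′)))
∏A-runLengths n k′ i = begin
  coeff (∏A (runLengths (suc k′) n)) i
    ≡⟨ cong (λ L → coeff (∏A L) i) (trans (runLengths-closed k′ n) (cong (applyUpTo (runLength k′ n)) (sym t+s≡k))) ⟩
  coeff (∏A (applyUpTo (runLength k′ n) (t + s))) i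
    ≡⟨ ∏A-two-constants (n / k + 1) (n / k) t s (runLength k′ n) (runLength-long k′ n) (runLength-short k′ n) i ⟩
  coeff ((A (n / k + 1) ^ₚ t) ⊗ (A (n / k) ^ₚ s)) i ∎
  where
  k = suc k′
  t = n % k
  s = k ∸ n % k
  t+s≡k : t + s ≡ k
  t+s≡k = m+[n∸m]≡n (<⇒≤ (m%n<n n k))

runLengths-runLen : ∀ n k′ → suc k′ ≤ n → runLengths (suc k′) n ≡ applyUpTo (runLen n (suc k′) ∘ suc) (suc k′)
runLengths-runLen n k′ k≤n = trans (runLengths-closed k′ n) (applyUpTo-cong k closedForm)
  where
  k = suc k′
  closedForm : ∀ j → j < k → runLength k′ n j ≡ runLen n k (suc j)
  closedForm j j<k = begin
    (n + k ∸ suc j) / k    ≡⟨ cong (_/ k) (+-∸-comm k (≤-trans j<k k≤n)) ⟩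
    ((n ∸ suc j) + k) / k  ≡⟨ [m+n]/n≡1+m/n (n ∸ suc j) k ⟩
    suc ((n ∸ suc j) / k)  ≡⟨ +-comm 1 _ ⟩
    (n ∸ suc j) / k + 1    ∎

multinomial-runLengths : ∀ n k′ → suc k′ ≤ n → multinomial n (runLengths (suc k′) n) ≡ I0formula n (suc k′)
multinomial-runLengths n k′ k≤n = begin
  multinomial n (runLengths k n)
    ≡⟨ cong (multinomial n) runLengths≡ ⟩
  multinomial n (applyUpTo λ′ k′ ++ [ λ′ k′ ])
    ≡⟨ multinomial-∷ʳ-rest n (applyUpTo λ′ k′) (λ′ k′) total ⟩
  multinomial n (applyUpTo λ′ k′)
    ≡⟨ product-binomials k′ n λ′ ⟨
  product (applyUpTo (λ j → (n ∸ sum (applyUpTo λ′ j)) C λ′ j) k′)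
    ≡⟨ cong product (applyUpTo-cong k′ (λ j _ → cong (λ z → (n ∸ z) C λ′ j) (cong sum (map-applyUpTo suc (runLen n k) j)))) ⟨
  product (applyUpTo (λ j → (n ∸ runSum n k (suc j)) C λ′ j) k′)
    ≡⟨ cong product (sym (trans (cong (map _) (map-applyUpTo (λ x → x) suc k′)) (map-applyUpTo suc _ k′))) ⟩
  I0formula n k ∎
  where
  k = suc k′
  λ′ : ℕ → ℕ
  λ′ = runLen n k ∘ suc

  runLengths≡ : runLengths k n ≡ applyUpTo λ′ k′ ++ [ λ′ k′ ]
  runLengths≡ = trans (runLengths-runLen n k′ k≤n) (sym (applyUpTo-∷ʳ λ′ k′))

  total : sum (applyUpTo λ′ k′) + λ′ k′ ≡ n
  total = begin
    sum (applyUpTo λ′ k′) + λ′ k′             ≡⟨ cong (sum (applyUpTo λ′ k′) +_) (+-identityʳ _) ⟨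
    sum (applyUpTo λ′ k′) + sum [ λ′ k′ ]     ≡⟨ sum-++ (applyUpTo λ′ k′) [ λ′ k′ ] ⟨
    sum (applyUpTo λ′ k′ ++ [ λ′ k′ ])        ≡⟨ cong sum runLengths≡ ⟨
    sum (runLengths k n)                      ≡⟨ sum-runLengths k′ n ⟩
    n                                         ∎

I-runs : ∀ n k′ i → I n (suc k′) i ≡ multinomial n (runLengths (suc k′) n) * coeff (∏A (runLengths (suc k′) n)) i
I-runs n k′ i = begin
  countℕ (invₖ (suc k′)) i (perms n)
    ≡⟨ countℕ-cong (invₖ-invʷ k′) i (perms n) ⟩
  countℕ (invʷ k′ ∘ word) i (perms n)
    ≡⟨ countℕ-perms n (invʷ k′) i ⟩
  ∑ʷ n n (λ w → distinctIn allAvail w * 𝟙 (invʷ k′ w ≡ᵇ i))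
    ≡⟨ ∑ʷ-cong n n (λ w → cong₂ (λ D d → D * 𝟙 (d ≡ᵇ i))
         (distinctIn-resp-↭ allAvail (↭.↭-sym (concat-runs-↭ k′ w))) (invʷ-runs k′ w)) ⟩
  ∑ʷ n n (runsWith allAvail i ∘ runs (suc k′))
    ≡⟨ ∑ʷ-runs n k′ n (runsWith allAvail i) ⟩
  ∑ʷˢ n L (runsWith allAvail i)
    ≡⟨ factorises n L allAvail i ⟩
  multinomial (card n allAvail) L * coeff (∏A L) i
    ≡⟨ cong (λ c → multinomial c L * coeff (∏A L) i) (card-allAvail n) ⟩
  multinomial n L * coeff (∏A L) i ∎
  where
  L = runLengths (suc k′) n

theorem4p4 : (n k : ℕ) → .{{_ : NonZero k}} → k ≤ n →
    ((i : ℕ) → I n k i ≡ coeff (scale (I n k 0) ((A (n / k + 1) ^ₚ (n % k)) ⊗ (A (n / k) ^ₚ (k ∸ n % k)))) i)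
    × (I n k 0 ≡ I0formula n k)
theorem4p4 n k@(suc k′) k≤n = factorisation , trans I₀≡multinomial (multinomial-runLengths n k′ k≤n)
  where
  L = runLengths k n
  P = (A (n / k + 1) ^ₚ (n % k)) ⊗ (A (n / k) ^ₚ (k ∸ n % k))

  I₀≡multinomial : I n k 0 ≡ multinomial n L
  I₀≡multinomial = trans (I-runs n k′ 0) (trans (cong (multinomial n L *_) (coeff-∏A-0 L)) (*-identityʳ _))

  factorisation : ∀ i → I n k i ≡ coeff (scale (I n k 0) P) i
  factorisation i = begin
    I n k i                            ≡⟨ I-runs n k′ i ⟩
    multinomial n L * coeff (∏A L) i   ≡⟨ cong₂ _*_ (sym I₀≡multinomial) (∏A-runLengths n k′ i) ⟩
    I n k 0 * coeff P i                ≡⟨ coeff-scale (I n k 0) P i ⟨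
    coeff (scale (I n k 0) P) i        ∎
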